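{- For all $i\in\mathbb{Z}$ and $m,k,l\in\mathbb{Z}_{\geq0}$, \begin{align*} N_{i,m,k,l}&=\frac{(m+l)_{m+1}}{m+1}(k+l)_{2l}(i-1/2)_{2i+m-k}(i+m+k+1/2)_{k-l}(i+2m+l+1/2)_{l-1}\\ &\quad\cdot(y+m+k+1/2)_{k-l}(y+m-k-1/2)_{2m-2k}(y-m-l-3/2)_{k-l}\\ &\quad\cdot\Bigl\{(y^2-i^2)(i+3m+l+5/2)+(i+m+l+1/2)(i+m-k+1/2)(i+m+k+3/2)\Bigr\}. \end{align*}
   Context: Falling factorials: for an integer $k\geq0$, $(\alpha)_k=\alpha(\alpha-1)\cdots(\alpha-k+1)$, $(\alpha)_0=1$; for a negative integer $k=-n$, $(\alpha)_{ -n}=1/((\alpha+1)(\alpha+2)\cdots(\alpha+n))$ (i.e. $(\alpha)_k=\Gamma(\alpha+1)/\Gamma(\alpha-k+1)$). All expressions are rational functions of a variable $y$ over $\mathbb{Q}$. For $i\in\mathbb{Z}$ and $m,k,t\in\mathbb{Z}_{\geq0}$ define \begin{align*} G_{i,m,k,t}&=-(i-1/2)_{2i+m-k}(y+m-k-1/2)_{2m-2k}(m+t)_m(k+t)_{2t}(i+2m+t+1/2)_t\\ &\quad\cdot(i+m+k+1/2)_{k-t}(y+m+k+1/2)_{k-t}(y-m-t-3/2)_{k-t}, \end{align*} $U_{i,m,k,l}=\sum_{t=l}^{k}G_{i,m,k,t}$ (empty sum $=0$), and $$N_{i,m,k,l}=-2U_{i+1,m,k,l}+\Bigl\{\bigl(k+\tfrac12\bigr)^2+y^2-(i+m+1)^2-i^2\Bigr\}U_{i,m,k,l}-\frac{2i-1}{2m+2}U_{i-1,m+1,k,l}.$$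 -}

module Defs where

open import Data.Nat as ℕ using (ℕ; zero; suc; _∸_)
open import Data.Integer as ℤ using (ℤ; +_; -[1+_])
open import Data.Rational using (ℚ; 0ℚ; 1ℚ; _+_; _*_; _-_; -_; 1/_; _/_; ≢-nonZero)
open import Data.Rational.Properties using (_≟_)
open import Relation.Nullary using (yes; no)

ℕ→ℚ : ℕ → ℚ
ℕ→ℚ n = (+ n) / 1

ℤ→ℚ : ℤ → ℚ
ℤ→ℚ z = z / 1

half : ℚ
half = (+ 1) / 2

-- total reciprocal (0 ↦ 0); only ever applied to nonzero values in lemma3
-- when y is not a half-integer
inv : ℚ → ℚ
inv x with x ≟ 0ℚ
... | yes _ = 0ℚ
... | no p  = 1/_ x {{≢-nonZero p}}

risingDownProd : ℚ → ℕ → ℚ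
risingDownProd α zero    = 1ℚ
risingDownProd α (suc n) = risingDownProd α n * (α - ℕ→ℚ n)

upProd : ℚ → ℕ → ℚ
upProd α zero    = 1ℚ
upProd α (suc n) = upProd α n * (α + ℕ→ℚ (suc n))

-- falling factorial (α)_k = Γ(α+1)/Γ(α-k+1), k ∈ ℤ
ff : ℚ → ℤ → ℚ
ff α (+ n)     = risingDownProd α n
ff α -[1+ n ]  = inv (upProd α (suc n))

-- Σ_{t=l}^{k} f t  (empty, = 0, if l > k)
sumFromTo : ℕ → ℕ → (ℕ → ℚ) → ℚ
sumFromTo l k f = go (suc k ∸ l)
  where
  go : ℕ → ℚ
  go zero    = 0ℚ
  go (suc j) = go j + f (l ℕ.+ j)

open import Relation.Binary.PropositionalEquality using (_≡_)
open import Data.Product using (∃)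

HalfInteger : ℚ → Set
HalfInteger y = ∃ λ (z : ℤ) → y ≡ ℤ→ℚ z + half

module _ (y : ℚ) where
  G : ℤ → ℕ → ℕ → ℕ → ℚ
  G i m k t =
    - (ff (ℤ→ℚ i - half) ((ℤ.+ 2) ℤ.* i ℤ.+ + m ℤ.- + k)
      * ff (y + ℕ→ℚ m - ℕ→ℚ k - half) ((ℤ.+ 2) ℤ.* + m ℤ.- (ℤ.+ 2) ℤ.* + k)
      * ff (ℕ→ℚ (m ℕ.+ t)) (+ m)
      * ff (ℕ→ℚ (k ℕ.+ t)) (+ (2 ℕ.* t))
      * ff (ℤ→ℚ i + ℕ→ℚ (2 ℕ.* m ℕ.+ t) + half) (+ t)
      * ff (ℤ→ℚ i + ℕ→ℚ (m ℕ.+ k) + half) (+ k ℤ.- + t)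
      * ff (y + ℕ→ℚ (m ℕ.+ k) + half) (+ k ℤ.- + t)
      * ff (y - ℕ→ℚ (m ℕ.+ t) - (+ 3) / 2) (+ k ℤ.- + t))

  U : ℤ → ℕ → ℕ → ℕ → ℚ
  U i m k l = sumFromTo l k (G i m k)

  N : ℤ → ℕ → ℕ → ℕ → ℚ
  N i m k l =
    - ((+ 2) / 1) * U (ℤ.suc i) m k l
    + ((ℕ→ℚ k + half) * (ℕ→ℚ k + half) + y * y
        - (ℤ→ℚ i + ℕ→ℚ (suc m)) * (ℤ→ℚ i + ℕ→ℚ (suc m))
        - ℤ→ℚ i * ℤ→ℚ i) * U i m k l
    - (ℤ→ℚ ((ℤ.+ 2) ℤ.* i ℤ.- ℤ.+ 1) * inv (ℕ→ℚ (2 ℕ.* m ℕ.+ 2))) * U (ℤ.pred i) (suc m) k l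

  RHS : ℤ → ℕ → ℕ → ℕ → ℚ
  RHS i m k l =
    ff (ℕ→ℚ (m ℕ.+ l)) (+ suc m) * inv (ℕ→ℚ (suc m))
    * ff (ℕ→ℚ (k ℕ.+ l)) (+ (2 ℕ.* l))
    * ff (ℤ→ℚ i - half) ((ℤ.+ 2) ℤ.* i ℤ.+ + m ℤ.- + k)
    * ff (ℤ→ℚ i + ℕ→ℚ (m ℕ.+ k) + half) (+ k ℤ.- + l)
    * ff (ℤ→ℚ i + ℕ→ℚ (2 ℕ.* m ℕ.+ l) + half) (+ l ℤ.- ℤ.+ 1)
    * ff (y + ℕ→ℚ (m ℕ.+ k) + half) (+ k ℤ.- + l)
    * ff (y + ℕ→ℚ m - ℕ→ℚ k - half) ((ℤ.+ 2) ℤ.* + m ℤ.- (ℤ.+ 2) ℤ.* + k)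
    * ff (y - ℕ→ℚ (m ℕ.+ l) - (+ 3) / 2) (+ k ℤ.- + l)
    * ( (y * y - ℤ→ℚ i * ℤ→ℚ i) * (ℤ→ℚ i + ℕ→ℚ (3 ℕ.* m ℕ.+ l) + (+ 5) / 2)
      + (ℤ→ℚ i + ℕ→ℚ (m ℕ.+ l) + half)
        * (ℤ→ℚ i + ℕ→ℚ m - ℕ→ℚ k + half)
        * (ℤ→ℚ i + ℕ→ℚ (m ℕ.+ k) + (+ 3) / 2))

{-# OPTIONS --safe #-}
module Submission where

-- N is a combination of three sums over t = l … k, hence the sum over t of the summand
-- −2 G(i+1,m,k,t) + c G(i,m,k,t) − (2i−1)/(2m+2) G(i−1,m+1,k,t), with c the middle coefficient.  It
-- equals RHS(t) − RHS(t+1), so the sum telescopes to RHS(l) − RHS(k+1), and RHS(L) = 0 for L > k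
-- because of its factor (k+L)_{2L}.  For the telescoping step, the recurrences
-- (α)_{n+1} = (α)_n (α − n) = α (α − 1)_n, which hold for every integer n as long as α is not a
-- non-positive integer (every α involved is a half-integer or y plus a half-integer), write each factor
-- of the three G's and of RHS(t), RHS(t+1) as a polynomial times one of eight falling factorials
-- common to all of them.  Cancelling their product and the factor 1/(m+1) leaves a polynomial
-- identity in y, i, m, t, k.

open import Defs
open import Data.Nat using (ℕ)
open import Data.Integer using (ℤ)
open import Data.Rational using (ℚ)
open import Relation.Binary.PropositionalEquality using (_≡_)
open import Relation.Nullary using (¬_)

import Algebra.Properties.Group as GroupProperties
open import Data.Empty using (⊥-elim)
open import Data.Integer.Base as ℤ using (+_; -[1+_]; 1ℤ; -1ℤ)
import Data.Integer.GCD as ℤ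
import Data.Integer.Properties as ℤP
import Data.Integer.Tactic.RingSolver as ℤ-Solver
import Data.Nat.Tactic.RingSolver as ℕ-Solver
open import Data.List.Base using (_∷_; [])
open import Data.Nat.Base as ℕ using (zero; suc; _∸_; _<_)
import Data.Nat.Properties as ℕP
open import Data.Product.Base using (_,_)
open import Data.Rational.Base as ℚ using (mkℚ; 0ℚ; 1ℚ; _+_; _*_; _-_; -_; _/_; ↥_; ↧_; ↧ₙ_)
import Data.Rational.Properties as ℚP
open import Data.Sum.Base using (inj₁; inj₂)
open import Relation.Binary.PropositionalEquality using (_≢_; refl; sym; trans; cong; cong₂; subst; module ≡-Reasoning)
open import Relation.Nullary.Decidable using (yes; no; dec⇒maybe)
open import Tactic.RingSolver using (solve-∀; solve)
open import Tactic.RingSolver.Core.AlmostCommutativeRing using (AlmostCommutativeRing; fromCommutativeRing)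

open GroupProperties ℚP.+-0-group using (inverseˡ-unique; inverseʳ-unique; ⁻¹-involutive)
open ≡-Reasoning

-- The zero test lets cancelled coefficients disappear from the solver's normal forms.
ℚ-ring : AlmostCommutativeRing _ _
ℚ-ring = fromCommutativeRing ℚP.+-*-commutativeRing (λ x → dec⇒maybe (0ℚ ℚP.≟ x))

↥-ℤ→ℚ : ∀ z → ↥ ℤ→ℚ z ≡ z
↥-ℤ→ℚ z = begin
  ↥ ℤ→ℚ z                 ≡⟨ ℤP.*-identityʳ _ ⟨
  ↥ ℤ→ℚ z ℤ.* 1ℤ          ≡⟨ cong (↥ ℤ→ℚ z ℤ.*_) (ℤ.gcd-zeroʳ z) ⟨
  ↥ ℤ→ℚ z ℤ.* ℤ.gcd z 1ℤ  ≡⟨ ℚP.↥-/ z 1 ⟩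
  z                       ∎

↧-ℤ→ℚ : ∀ z → ↧ ℤ→ℚ z ≡ 1ℤ
↧-ℤ→ℚ z = begin
  ↧ ℤ→ℚ z                 ≡⟨ ℤP.*-identityʳ _ ⟨
  ↧ ℤ→ℚ z ℤ.* 1ℤ          ≡⟨ cong (↧ ℤ→ℚ z ℤ.*_) (ℤ.gcd-zeroʳ z) ⟨
  ↧ ℤ→ℚ z ℤ.* ℤ.gcd z 1ℤ  ≡⟨ ℚP.↧-/ z 1 ⟩
  1ℤ                      ∎

↧ₙ-ℤ→ℚ : ∀ z → ↧ₙ ℤ→ℚ z ≡ 1
↧ₙ-ℤ→ℚ z = ℤP.+-injective (↧-ℤ→ℚ z)

+-unfold : ∀ p q → p + q ≡ (↥ p ℤ.* ↧ q ℤ.+ ↥ q ℤ.* ↧ p) / (↧ₙ p ℕ.* ↧ₙ q)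
+-unfold (mkℚ _ _ _) (mkℚ _ _ _) = refl

*-unfold : ∀ p q → p * q ≡ (↥ p ℤ.* ↥ q) / (↧ₙ p ℕ.* ↧ₙ q)
*-unfold (mkℚ _ _ _) (mkℚ _ _ _) = refl

ℤ→ℚ-homo-+ : ∀ a b → ℤ→ℚ (a ℤ.+ b) ≡ ℤ→ℚ a + ℤ→ℚ b
ℤ→ℚ-homo-+ a b = sym (trans (+-unfold (ℤ→ℚ a) (ℤ→ℚ b)) (ℚP./-cong numerator denominator))
  where
  numerator : ↥ ℤ→ℚ a ℤ.* ↧ ℤ→ℚ b ℤ.+ ↥ ℤ→ℚ b ℤ.* ↧ ℤ→ℚ a ≡ a ℤ.+ b
  numerator = begin
    ↥ ℤ→ℚ a ℤ.* ↧ ℤ→ℚ b ℤ.+ ↥ ℤ→ℚ b ℤ.* ↧ ℤ→ℚ a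
      ≡⟨ cong₂ (λ u v → u ℤ.* ↧ ℤ→ℚ b ℤ.+ v ℤ.* ↧ ℤ→ℚ a) (↥-ℤ→ℚ a) (↥-ℤ→ℚ b) ⟩
    a ℤ.* ↧ ℤ→ℚ b ℤ.+ b ℤ.* ↧ ℤ→ℚ a
      ≡⟨ cong₂ (λ u v → a ℤ.* u ℤ.+ b ℤ.* v) (↧-ℤ→ℚ b) (↧-ℤ→ℚ a) ⟩
    a ℤ.* 1ℤ ℤ.+ b ℤ.* 1ℤ
      ≡⟨ cong₂ ℤ._+_ (ℤP.*-identityʳ a) (ℤP.*-identityʳ b) ⟩
    a ℤ.+ b ∎
  denominator : ↧ₙ ℤ→ℚ a ℕ.* ↧ₙ ℤ→ℚ b ≡ 1
  denominator = cong₂ ℕ._*_ (↧ₙ-ℤ→ℚ a) (↧ₙ-ℤ→ℚ b)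

ℤ→ℚ-homo-* : ∀ a b → ℤ→ℚ (a ℤ.* b) ≡ ℤ→ℚ a * ℤ→ℚ b
ℤ→ℚ-homo-* a b = sym (trans (*-unfold (ℤ→ℚ a) (ℤ→ℚ b)) (ℚP./-cong numerator denominator))
  where
  numerator : ↥ ℤ→ℚ a ℤ.* ↥ ℤ→ℚ b ≡ a ℤ.* b
  numerator = cong₂ ℤ._*_ (↥-ℤ→ℚ a) (↥-ℤ→ℚ b)
  denominator : ↧ₙ ℤ→ℚ a ℕ.* ↧ₙ ℤ→ℚ b ≡ 1
  denominator = cong₂ ℕ._*_ (↧ₙ-ℤ→ℚ a) (↧ₙ-ℤ→ℚ b)

ℤ→ℚ-homo-neg : ∀ a → ℤ→ℚ (ℤ.- a) ≡ - ℤ→ℚ a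
ℤ→ℚ-homo-neg a = inverseˡ-unique (ℤ→ℚ (ℤ.- a)) (ℤ→ℚ a)
  (trans (sym (ℤ→ℚ-homo-+ (ℤ.- a) a)) (cong ℤ→ℚ (ℤP.+-inverseˡ a)))

ℤ→ℚ-homo-- : ∀ a b → ℤ→ℚ (a ℤ.- b) ≡ ℤ→ℚ a - ℤ→ℚ b
ℤ→ℚ-homo-- a b = trans (ℤ→ℚ-homo-+ a (ℤ.- b)) (cong (λ c → ℤ→ℚ a + c) (ℤ→ℚ-homo-neg b))

ℕ→ℚ-homo-+ : ∀ a b → ℕ→ℚ (a ℕ.+ b) ≡ ℕ→ℚ a + ℕ→ℚ b
ℕ→ℚ-homo-+ a b = ℤ→ℚ-homo-+ (+ a) (+ b)

ℕ→ℚ-homo-* : ∀ a b → ℕ→ℚ (a ℕ.* b) ≡ ℕ→ℚ a * ℕ→ℚ b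
ℕ→ℚ-homo-* a b = trans (cong ℤ→ℚ (ℤP.pos-* a b)) (ℤ→ℚ-homo-* (+ a) (+ b))

ℕ→ℚ-suc≢0 : ∀ n → ℕ→ℚ (suc n) ≢ 0ℚ
ℕ→ℚ-suc≢0 n eq with trans (sym (↥-ℤ→ℚ (+ suc n))) (cong ↥_ eq)
... | ()

inv-inverseˡ : ∀ {x} → x ≢ 0ℚ → inv x * x ≡ 1ℚ
inv-inverseˡ {x} x≢0 with x ℚP.≟ 0ℚ
... | yes x≡0  = ⊥-elim (x≢0 x≡0)
... | no  x≢0′ = ℚP.*-inverseˡ x {{ℚ.≢-nonZero x≢0′}}

*-≢0 : ∀ {x y} → x ≢ 0ℚ → y ≢ 0ℚ → x * y ≢ 0ℚ
*-≢0 {x} {y} x≢0 y≢0 xy≡0 = y≢0 (begin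
  y                ≡⟨ ℚP.*-identityˡ y ⟨
  1ℚ * y           ≡⟨ cong (_* y) (inv-inverseˡ x≢0) ⟨
  inv x * x * y    ≡⟨ ℚP.*-assoc (inv x) x y ⟩
  inv x * (x * y)  ≡⟨ cong (inv x *_) xy≡0 ⟩
  inv x * 0ℚ       ≡⟨ ℚP.*-zeroʳ (inv x) ⟩
  0ℚ               ∎)

inv-distrib-* : ∀ {x y} → x ≢ 0ℚ → y ≢ 0ℚ → inv (x * y) ≡ inv x * inv y
inv-distrib-* {x} {y} x≢0 y≢0 = begin
  inv (x * y)                                ≡⟨ ℚP.*-identityʳ _ ⟨
  inv (x * y) * (1ℚ * 1ℚ)                    ≡⟨ cong₂ (λ a b → inv (x * y) * (a * b)) (inv-inverseˡ x≢0) (inv-inverseˡ y≢0) ⟨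
  inv (x * y) * (inv x * x * (inv y * y))    ≡⟨ regroup (inv (x * y)) x y (inv x) (inv y) ⟩
  inv (x * y) * (x * y) * (inv x * inv y)    ≡⟨ cong (_* (inv x * inv y)) (inv-inverseˡ (*-≢0 x≢0 y≢0)) ⟩
  1ℚ * (inv x * inv y)                       ≡⟨ ℚP.*-identityˡ _ ⟩
  inv x * inv y                              ∎
  where
  regroup : ∀ u a b a′ b′ → u * (a′ * a * (b′ * b)) ≡ u * (a * b) * (a′ * b′)
  regroup = solve-∀ ℚ-ring

inv-*-cancelʳ : ∀ {x y} → x ≢ 0ℚ → y ≢ 0ℚ → inv (x * y) * y ≡ inv x
inv-*-cancelʳ {x} {y} x≢0 y≢0 = begin
  inv (x * y) * y        ≡⟨ cong (_* y) (inv-distrib-* x≢0 y≢0) ⟩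
  inv x * inv y * y      ≡⟨ ℚP.*-assoc (inv x) (inv y) y ⟩
  inv x * (inv y * y)    ≡⟨ cong (inv x *_) (inv-inverseˡ y≢0) ⟩
  inv x * 1ℚ             ≡⟨ ℚP.*-identityʳ (inv x) ⟩
  inv x                  ∎

*-inv-cancelˡ : ∀ {x y} → x ≢ 0ℚ → y ≢ 0ℚ → x * inv (x * y) ≡ inv y
*-inv-cancelˡ {x} {y} x≢0 y≢0 = begin
  x * inv (x * y)        ≡⟨ cong (x *_) (inv-distrib-* x≢0 y≢0) ⟩
  x * (inv x * inv y)    ≡⟨ ℚP.*-assoc x (inv x) (inv y) ⟨
  x * inv x * inv y      ≡⟨ cong (_* inv y) (trans (ℚP.*-comm x (inv x)) (inv-inverseˡ x≢0)) ⟩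
  1ℚ * inv y             ≡⟨ ℚP.*-identityˡ (inv y) ⟩
  inv y                  ∎

-- Half-integers

halfInteger-+ : ∀ {α} → HalfInteger α → ∀ z → HalfInteger (α + ℤ→ℚ z)
halfInteger-+ (w , refl) z = w ℤ.+ z , (begin
  ℤ→ℚ w + half + ℤ→ℚ z    ≡⟨ swap (ℤ→ℚ w) half (ℤ→ℚ z) ⟩
  ℤ→ℚ w + ℤ→ℚ z + half    ≡⟨ cong (_+ half) (ℤ→ℚ-homo-+ w z) ⟨
  ℤ→ℚ (w ℤ.+ z) + half    ∎)
  where
  swap : ∀ a b c → a + b + c ≡ a + c + b
  swap = solve-∀ ℚ-ring

halfInteger-neg : ∀ {α} → HalfInteger α → HalfInteger (- α)
halfInteger-neg (w , refl) = ℤ.- w ℤ.- 1ℤ , (begin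
  - (ℤ→ℚ w + half)              ≡⟨ reflect (ℤ→ℚ w) ⟩
  - ℤ→ℚ w - 1ℚ + half           ≡⟨ cong (λ a → a - 1ℚ + half) (ℤ→ℚ-homo-neg w) ⟨
  ℤ→ℚ (ℤ.- w) - 1ℚ + half       ≡⟨ cong (_+ half) (ℤ→ℚ-homo-- (ℤ.- w) 1ℤ) ⟨
  ℤ→ℚ (ℤ.- w ℤ.- 1ℤ) + half     ∎)
  where
  reflect : ∀ a → - (a + half) ≡ - a - 1ℚ + half
  reflect = solve-∀ ℚ-ring

halfInteger-ℤ-half : ∀ z → HalfInteger (ℤ→ℚ z - half)
halfInteger-ℤ-half z = z ℤ.- 1ℤ , (begin
  ℤ→ℚ z - half              ≡⟨ shift (ℤ→ℚ z) ⟩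
  ℤ→ℚ z - 1ℚ + half         ≡⟨ cong (_+ half) (ℤ→ℚ-homo-- z 1ℤ) ⟨
  ℤ→ℚ (z ℤ.- 1ℤ) + half     ∎)
  where
  shift : ∀ a → a - half ≡ a - 1ℚ + half
  shift = solve-∀ ℚ-ring

halfInteger-ℤ+ℕ+half : ∀ a b → HalfInteger (ℤ→ℚ a + ℕ→ℚ b + half)
halfInteger-ℤ+ℕ+half a b = a ℤ.+ + b , cong (_+ half) (sym (ℤ→ℚ-homo-+ a (+ b)))

halfInteger≢0 : ∀ {α} → HalfInteger α → α ≢ 0ℚ
halfInteger≢0 (w , refl) w+½≡0 = 2≢1 (trans (cong ↧ₙ_ half≡ℤ→ℚ[-w]) (↧ₙ-ℤ→ℚ (ℤ.- w)))
  where
  half≡ℤ→ℚ[-w] : half ≡ ℤ→ℚ (ℤ.- w)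
  half≡ℤ→ℚ[-w] = trans (inverseʳ-unique (ℤ→ℚ w) half w+½≡0) (sym (ℤ→ℚ-homo-neg w))
  2≢1 : 2 ≢ 1
  2≢1 ()

NotNonPositiveInteger : ℚ → Set
NotNonPositiveInteger α = ∀ j → α + ℕ→ℚ j ≢ 0ℚ

NotNegativeInteger : ℚ → Set
NotNegativeInteger α = ∀ j → α + ℕ→ℚ (suc j) ≢ 0ℚ

notNonPos⇒notNeg : ∀ {α} → NotNonPositiveInteger α → NotNegativeInteger α
notNonPos⇒notNeg α∉ j = α∉ (suc j)

notNonPos⇒≢0 : ∀ {α} → NotNonPositiveInteger α → α ≢ 0ℚ
notNonPos⇒≢0 {α} α∉ α≡0 = α∉ 0 (trans (ℚP.+-identityʳ α) α≡0)

halfInteger⇒notNonPos : ∀ {α} → HalfInteger α → NotNonPositiveInteger α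
halfInteger⇒notNonPos α∈ j = halfInteger≢0 (halfInteger-+ α∈ (+ j))

non-halfInteger+halfInteger⇒notNonPos : ∀ {y h} → ¬ HalfInteger y → HalfInteger h → NotNonPositiveInteger (y + h)
non-halfInteger+halfInteger⇒notNonPos {y} {h} y∉ h∈ j y+h+j≡0 =
  y∉ (subst HalfInteger (sym y≡-[h+j]) (halfInteger-neg (halfInteger-+ h∈ (+ j))))
  where
  y≡-[h+j] : y ≡ - (h + ℕ→ℚ j)
  y≡-[h+j] = inverseˡ-unique y (h + ℕ→ℚ j) (trans (sym (ℚP.+-assoc y h (ℕ→ℚ j))) y+h+j≡0)

-- Falling factorials

upProd≢0 : ∀ {α} → NotNegativeInteger α → ∀ n → upProd α n ≢ 0ℚ
upProd≢0 α∉ zero    = λ ()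
upProd≢0 α∉ (suc n) = *-≢0 (upProd≢0 α∉ n) (α∉ n)

risingDownProd-suc : ∀ α n → risingDownProd α (suc n) ≡ α * risingDownProd (α - 1ℚ) n
risingDownProd-suc α zero    = begin 1ℚ * (α - ℕ→ℚ 0) ≡⟨ solve (α ∷ []) ℚ-ring ⟩ α * 1ℚ ∎
risingDownProd-suc α (suc n) = begin
  risingDownProd α (suc n) * (α - ℕ→ℚ (suc n))
    ≡⟨ cong₂ (λ r j → r * (α - j)) (risingDownProd-suc α n) (ℕ→ℚ-homo-+ 1 n) ⟩
  α * risingDownProd (α - 1ℚ) n * (α - (1ℚ + ℕ→ℚ n))
    ≡⟨ regroup α (risingDownProd (α - 1ℚ) n) (ℕ→ℚ n) ⟩
  α * (risingDownProd (α - 1ℚ) n * (α - 1ℚ - ℕ→ℚ n)) ∎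
  where
  regroup : ∀ a r j → a * r * (a - (1ℚ + j)) ≡ a * (r * (a - 1ℚ - j))
  regroup = solve-∀ ℚ-ring

upProd-pred : ∀ α n → upProd (α - 1ℚ) (suc n) ≡ α * upProd α n
upProd-pred α zero    = begin 1ℚ * (α - 1ℚ + ℕ→ℚ 1) ≡⟨ solve (α ∷ []) ℚ-ring ⟩ α * 1ℚ ∎
upProd-pred α (suc n) = begin
  upProd (α - 1ℚ) (suc n) * (α - 1ℚ + ℕ→ℚ (suc (suc n)))
    ≡⟨ cong₂ (λ u j → u * (α - 1ℚ + j)) (upProd-pred α n) (ℕ→ℚ-homo-+ 1 (suc n)) ⟩
  α * upProd α n * (α - 1ℚ + (1ℚ + ℕ→ℚ (suc n)))
    ≡⟨ regroup α (upProd α n) (ℕ→ℚ (suc n)) ⟩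
  α * (upProd α n * (α + ℕ→ℚ (suc n))) ∎
  where
  regroup : ∀ a u j → a * u * (a - 1ℚ + (1ℚ + j)) ≡ a * (u * (a + j))
  regroup = solve-∀ ℚ-ring

ff-nonpositive : ∀ α n → ff α (-[1+ n ] ℤ.+ 1ℤ) ≡ inv (upProd α n)
ff-nonpositive α zero    = refl
ff-nonpositive α (suc n) = refl

ff-sucʳ : ∀ {α} → NotNegativeInteger α → ∀ z → ff α (z ℤ.+ 1ℤ) ≡ ff α z * (α - ℤ→ℚ z)
ff-sucʳ α∉ (+ n) rewrite ℕP.+-comm n 1 = refl
ff-sucʳ {α} α∉ -[1+ n ] = begin
  ff α (-[1+ n ] ℤ.+ 1ℤ)                      ≡⟨ ff-nonpositive α n ⟩
  inv (upProd α n)                            ≡⟨ inv-*-cancelʳ (upProd≢0 α∉ n) (α∉ n) ⟨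
  inv (upProd α (suc n)) * (α + ℕ→ℚ (suc n))  ≡⟨ cong (λ j → inv (upProd α (suc n)) * (α + j)) (⁻¹-involutive _) ⟨
  inv (upProd α (suc n)) * (α - - ℕ→ℚ (suc n)) ≡⟨ cong (λ j → inv (upProd α (suc n)) * (α - j)) (ℤ→ℚ-homo-neg (+ suc n)) ⟨
  ff α -[1+ n ] * (α - ℤ→ℚ -[1+ n ])          ∎

ff-sucˡ : ∀ {α} → NotNonPositiveInteger α → ∀ z → ff α (z ℤ.+ 1ℤ) ≡ α * ff (α - 1ℚ) z
ff-sucˡ α∉ (+ n) rewrite ℕP.+-comm n 1 = risingDownProd-suc _ n
ff-sucˡ {α} α∉ -[1+ n ] = begin
  ff α (-[1+ n ] ℤ.+ 1ℤ)             ≡⟨ ff-nonpositive α n ⟩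
  inv (upProd α n)                   ≡⟨ *-inv-cancelˡ (notNonPos⇒≢0 {α} α∉) (upProd≢0 (notNonPos⇒notNeg {α} α∉) n) ⟨
  α * inv (α * upProd α n)           ≡⟨ cong (λ u → α * inv u) (upProd-pred α n) ⟨
  α * ff (α - 1ℚ) -[1+ n ]           ∎

ff-stepʳ : ∀ {α v} z {z′} → NotNegativeInteger α → z′ ≡ z ℤ.+ 1ℤ → α - ℤ→ℚ z ≡ v → ff α z′ ≡ ff α z * v
ff-stepʳ {α} z α∉ refl α-z≡v = trans (ff-sucʳ α∉ z) (cong (ff α z *_) α-z≡v)

ff-stepˡ : ∀ {α α′ v} z {z′} → NotNonPositiveInteger α → z′ ≡ z ℤ.+ 1ℤ → α - 1ℚ ≡ α′ → α ≡ v →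
           ff α z′ ≡ v * ff α′ z
ff-stepˡ z α∉ refl α-1≡α′ α≡v =
  trans (ff-sucˡ α∉ z) (cong₂ (λ u β → u * ff β z) α≡v α-1≡α′)

risingDownProd-vanishes : ∀ {a n} → a < n → risingDownProd (ℕ→ℚ a) n ≡ 0ℚ
risingDownProd-vanishes {a} {suc n} a<1+n with ℕP.m≤n⇒m<n∨m≡n (ℕP.≤-pred a<1+n)
... | inj₁ a<n  = trans (cong (_* (ℕ→ℚ a - ℕ→ℚ n)) (risingDownProd-vanishes a<n)) (ℚP.*-zeroˡ (ℕ→ℚ a - ℕ→ℚ n))
... | inj₂ refl = trans (cong (risingDownProd (ℕ→ℚ a) a *_) (ℚP.+-inverseʳ (ℕ→ℚ a))) (ℚP.*-zeroʳ (risingDownProd (ℕ→ℚ a) a))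

-- Finite sums

sumFrom : ℕ → (ℕ → ℚ) → ℕ → ℚ
sumFrom l f zero    = 0ℚ
sumFrom l f (suc n) = sumFrom l f n + f (l ℕ.+ n)

sumFrom-unique : ∀ l f (g : ℕ → ℚ) → g 0 ≡ 0ℚ → (∀ n → g (suc n) ≡ g n + f (l ℕ.+ n)) →
                 ∀ n → g n ≡ sumFrom l f n
sumFrom-unique l f g g0 gsuc zero    = g0
sumFrom-unique l f g g0 gsuc (suc n) = trans (gsuc n) (cong (_+ f (l ℕ.+ n)) (sumFrom-unique l f g g0 gsuc n))

-- The local recursion of sumFromTo cannot be named; it is identified by its defining equations.
sumFromTo≡sumFrom : ∀ l k f → sumFromTo l k f ≡ sumFrom l f (suc k ∸ l)
sumFromTo≡sumFrom l k f with suc k ∸ l | sumFrom-unique l f _ refl (λ _ → refl)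
... | n | go≡sumFrom = go≡sumFrom n

sumFrom-linear : ∀ l (f g h : ℕ → ℚ) a b c n →
  a * sumFrom l f n + b * sumFrom l g n - c * sumFrom l h n ≡ sumFrom l (λ j → a * f j + b * g j - c * h j) n
sumFrom-linear l f g h a b c zero    = begin a * 0ℚ + b * 0ℚ - c * 0ℚ ≡⟨ solve (a ∷ b ∷ c ∷ []) ℚ-ring ⟩ 0ℚ ∎
sumFrom-linear l f g h a b c (suc n) = trans
  (distribute a b c (sumFrom l f n) (sumFrom l g n) (sumFrom l h n) (f (l ℕ.+ n)) (g (l ℕ.+ n)) (h (l ℕ.+ n)))
  (cong (_+ (a * f (l ℕ.+ n) + b * g (l ℕ.+ n) - c * h (l ℕ.+ n))) (sumFrom-linear l f g h a b c n))
  where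
  distribute : ∀ a b c F G H x y z →
    a * (F + x) + b * (G + y) - c * (H + z) ≡ (a * F + b * G - c * H) + (a * x + b * y - c * z)
  distribute = solve-∀ ℚ-ring

sumFromTo-linear : ∀ l k (f g h : ℕ → ℚ) a b c →
  a * sumFromTo l k f + b * sumFromTo l k g - c * sumFromTo l k h ≡ sumFromTo l k (λ j → a * f j + b * g j - c * h j)
sumFromTo-linear l k f g h a b c = begin
  a * sumFromTo l k f + b * sumFromTo l k g - c * sumFromTo l k h
    ≡⟨ cong₂ _-_ (cong₂ _+_ (cong (a *_) (sumFromTo≡sumFrom l k f)) (cong (b *_) (sumFromTo≡sumFrom l k g)))
                 (cong (c *_) (sumFromTo≡sumFrom l k h)) ⟩
  a * sumFrom l f (suc k ∸ l) + b * sumFrom l g (suc k ∸ l) - c * sumFrom l h (suc k ∸ l)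
    ≡⟨ sumFrom-linear l f g h a b c (suc k ∸ l) ⟩
  sumFrom l (λ j → a * f j + b * g j - c * h j) (suc k ∸ l)
    ≡⟨ sumFromTo≡sumFrom l k _ ⟨
  sumFromTo l k (λ j → a * f j + b * g j - c * h j) ∎

sumFrom-telescope : ∀ l (f R : ℕ → ℚ) → (∀ j → f j ≡ R j - R (suc j)) → ∀ n → sumFrom l f n ≡ R l - R (l ℕ.+ n)
sumFrom-telescope l f R f≡ΔR zero    = sym (trans (cong (λ j → R l - R j) (ℕP.+-identityʳ l)) (ℚP.+-inverseʳ (R l)))
sumFrom-telescope l f R f≡ΔR (suc n) = begin
  sumFrom l f n + f (l ℕ.+ n)                                 ≡⟨ cong₂ _+_ (sumFrom-telescope l f R f≡ΔR n) (f≡ΔR (l ℕ.+ n)) ⟩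
  R l - R (l ℕ.+ n) + (R (l ℕ.+ n) - R (suc (l ℕ.+ n)))      ≡⟨ cancel (R l) (R (l ℕ.+ n)) (R (suc (l ℕ.+ n))) ⟩
  R l - R (suc (l ℕ.+ n))                                     ≡⟨ cong (λ j → R l - R j) (ℕP.+-suc l n) ⟨
  R l - R (l ℕ.+ suc n)                                       ∎
  where
  cancel : ∀ a b c → a - b + (b - c) ≡ a - c
  cancel = solve-∀ ℚ-ring

-- One summand of N

*-cong₈ : ∀ {a₁ a₂ a₃ a₄ a₅ a₆ a₇ a₈ b₁ b₂ b₃ b₄ b₅ b₆ b₇ b₈ : ℚ} →
          a₁ ≡ b₁ → a₂ ≡ b₂ → a₃ ≡ b₃ → a₄ ≡ b₄ → a₅ ≡ b₅ → a₆ ≡ b₆ → a₇ ≡ b₇ → a₈ ≡ b₈ →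
          a₁ * a₂ * a₃ * a₄ * a₅ * a₆ * a₇ * a₈ ≡ b₁ * b₂ * b₃ * b₄ * b₅ * b₆ * b₇ * b₈
*-cong₈ refl refl refl refl refl refl refl refl = refl

*-cong₁₀ : ∀ {a₁ a₂ a₃ a₄ a₅ a₆ a₇ a₈ a₉ a₁₀ b₁ b₂ b₃ b₄ b₅ b₆ b₇ b₈ b₉ b₁₀ : ℚ} →
           a₁ ≡ b₁ → a₂ ≡ b₂ → a₃ ≡ b₃ → a₄ ≡ b₄ → a₅ ≡ b₅ → a₆ ≡ b₆ → a₇ ≡ b₇ → a₈ ≡ b₈ → a₉ ≡ b₉ → a₁₀ ≡ b₁₀ →
           a₁ * a₂ * a₃ * a₄ * a₅ * a₆ * a₇ * a₈ * a₉ * a₁₀ ≡ b₁ * b₂ * b₃ * b₄ * b₅ * b₆ * b₇ * b₈ * b₉ * b₁₀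
*-cong₁₀ refl refl refl refl refl refl refl refl refl refl = refl

*-zero₃ : ∀ a₁ a₂ {a₃} a₄ a₅ a₆ a₇ a₈ a₉ a₁₀ → a₃ ≡ 0ℚ →
          a₁ * a₂ * a₃ * a₄ * a₅ * a₆ * a₇ * a₈ * a₉ * a₁₀ ≡ 0ℚ
*-zero₃ a₁ a₂ a₄ a₅ a₆ a₇ a₈ a₉ a₁₀ refl = absorb a₁ a₂ a₄ a₅ a₆ a₇ a₈ a₉ a₁₀
  where
  absorb : ∀ a₁ a₂ a₄ a₅ a₆ a₇ a₈ a₉ a₁₀ → a₁ * a₂ * 0ℚ * a₄ * a₅ * a₆ * a₇ * a₈ * a₉ * a₁₀ ≡ 0ℚ
  absorb = solve-∀ ℚ-ring

summand-identity : ∀ y I M T K →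
  (M + 1ℚ) * ((+ 2) / 1 * ((I + half) * (I - half) * (K - I - M - half) * (I + M + M + T + (+ 3) / 2)
                             * (I + M + K + (+ 3) / 2) * (y + M + T + (+ 3) / 2) * (y - M - T - (+ 3) / 2))
              - ((K + half) * (K + half) + y * y - (I + M + 1ℚ) * (I + M + 1ℚ) - I * I)
                * ((I - half) * (I + M + M + (+ 3) / 2) * (I + M + T + (+ 3) / 2) * (y + M + T + (+ 3) / 2) * (y - M - T - (+ 3) / 2)))
  + (I - half) * ((y + M - K + half) * (y - M + K - half) * (M + T + 1ℚ) * (I + M + M + T + (+ 3) / 2)
                  * (I + M + T + (+ 3) / 2) * (y + M + K + (+ 3) / 2) * (y - M - K - (+ 3) / 2))
  ≡ T * (I - half) * (I + M + T + (+ 3) / 2) * (y + M + T + (+ 3) / 2) * (y - M - T - (+ 3) / 2)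
      * ((y * y - I * I) * (I + M + M + M + T + (+ 5) / 2) + (I + M + T + half) * (I + M - K + half) * (I + M + K + (+ 3) / 2))
    - (M + T + 1ℚ) * (K + T + 1ℚ) * (K - T) * (I - half) * (I + M + M + T + (+ 3) / 2)
      * ((y * y - I * I) * (I + M + M + M + T + (+ 7) / 2) + (I + M + T + (+ 3) / 2) * (I + M - K + half) * (I + M + K + (+ 3) / 2))
summand-identity = solve-∀ ℚ-ring

clear-denominator : ∀ Π {w M a c g₁ g₀ g₂ r₀ r₁} → w * (M + 1ℚ) ≡ 1ℚ →
  (M + 1ℚ) * ((+ 2) / 1 * g₁ - c * g₀) + a * g₂ ≡ r₀ - r₁ →
  - ((+ 2) / 1) * - (Π * g₁) + c * - (Π * g₀) - w * a * - (Π * g₂) ≡ w * Π * r₀ - w * Π * r₁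
clear-denominator Π {w} {M} {a} {c} {g₁} {g₀} {g₂} {r₀} {r₁} w[M+1]≡1 identity = begin
  - ((+ 2) / 1) * - (Π * g₁) + c * - (Π * g₀) - w * a * - (Π * g₂)
    ≡⟨ solve (Π ∷ w ∷ a ∷ c ∷ g₁ ∷ g₀ ∷ g₂ ∷ []) ℚ-ring ⟩
  1ℚ * (Π * ((+ 2) / 1 * g₁ - c * g₀)) + w * Π * (a * g₂)
    ≡⟨ cong (λ u → u * (Π * ((+ 2) / 1 * g₁ - c * g₀)) + w * Π * (a * g₂)) w[M+1]≡1 ⟨
  w * (M + 1ℚ) * (Π * ((+ 2) / 1 * g₁ - c * g₀)) + w * Π * (a * g₂)
    ≡⟨ solve (Π ∷ w ∷ M ∷ a ∷ c ∷ g₁ ∷ g₀ ∷ g₂ ∷ []) ℚ-ring ⟩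
  w * Π * ((M + 1ℚ) * ((+ 2) / 1 * g₁ - c * g₀) + a * g₂)
    ≡⟨ cong (w * Π *_) identity ⟩
  w * Π * (r₀ - r₁)
    ≡⟨ solve (w ∷ Π ∷ r₀ ∷ r₁ ∷ []) ℚ-ring ⟩
  w * Π * r₀ - w * Π * r₁ ∎

N-middle-coefficient : ℚ → ℤ → ℕ → ℕ → ℚ
N-middle-coefficient y i m k =
  (ℕ→ℚ k + half) * (ℕ→ℚ k + half) + y * y - (ℤ→ℚ i + ℕ→ℚ (suc m)) * (ℤ→ℚ i + ℕ→ℚ (suc m)) - ℤ→ℚ i * ℤ→ℚ i

N-last-coefficient : ℤ → ℕ → ℚ
N-last-coefficient i m = ℤ→ℚ ((ℤ.+ 2) ℤ.* i ℤ.- ℤ.+ 1) * inv (ℕ→ℚ (2 ℕ.* m ℕ.+ 2))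

N-summand : ℚ → ℤ → ℕ → ℕ → ℕ → ℚ
N-summand y i m k t =
  - ((+ 2) / 1) * G y (ℤ.suc i) m k t
  + N-middle-coefficient y i m k * G y i m k t
  - N-last-coefficient i m * G y (ℤ.pred i) (suc m) k t

-- Naming every quantity by a module parameter, instantiated by refl, lets the ring solver treat them as variables.
module Summand {y : ℚ} (y∉½ℤ : ¬ HalfInteger y) {i : ℤ} {m k t : ℕ}
  {I M K T w A B P Q X Y Z V : ℚ}
  (I≡ : ℤ→ℚ i ≡ I) (M≡ : ℕ→ℚ m ≡ M) (K≡ : ℕ→ℚ k ≡ K) (T≡ : ℕ→ℚ t ≡ T)
  (w≡ : inv (ℕ→ℚ (suc m)) ≡ w)
  (A≡ : ff (ℤ→ℚ (ℤ.pred i) - half) ((ℤ.+ 2) ℤ.* ℤ.pred i ℤ.+ + suc m ℤ.- + k) ≡ A)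
  (B≡ : ff (y + ℕ→ℚ m - ℕ→ℚ k - half) ((ℤ.+ 2) ℤ.* + m ℤ.- (ℤ.+ 2) ℤ.* + k) ≡ B)
  (P≡ : ff (ℕ→ℚ (m ℕ.+ t)) (+ m) ≡ P)
  (Q≡ : ff (ℕ→ℚ (k ℕ.+ t)) (+ (2 ℕ.* t)) ≡ Q)
  (X≡ : ff (ℤ→ℚ i + ℕ→ℚ (2 ℕ.* m ℕ.+ t) + half) (+ t ℤ.- ℤ.+ 1) ≡ X)
  (Y≡ : ff (ℤ→ℚ i + ℕ→ℚ (m ℕ.+ k) + half) (+ k ℤ.- + suc t) ≡ Y)
  (Z≡ : ff (y + ℕ→ℚ (m ℕ.+ k) + half) (+ k ℤ.- + suc t) ≡ Z)
  (V≡ : ff (y - ℕ→ℚ (m ℕ.+ suc t) - (+ 3) / 2) (+ k ℤ.- + suc t) ≡ V)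
  where

  suc-i≡ : ℤ→ℚ (ℤ.suc i) ≡ 1ℚ + I
  suc-i≡ = trans (ℤ→ℚ-homo-+ 1ℤ i) (cong (λ a → 1ℚ + a) I≡)

  pred-i≡ : ℤ→ℚ (ℤ.pred i) ≡ - 1ℚ + I
  pred-i≡ = trans (ℤ→ℚ-homo-+ -1ℤ i) (cong (λ a → - 1ℚ + a) I≡)

  suc-m≡ : ℕ→ℚ (suc m) ≡ 1ℚ + M
  suc-m≡ = trans (ℕ→ℚ-homo-+ 1 m) (cong (λ a → 1ℚ + a) M≡)

  suc-t≡ : ℕ→ℚ (suc t) ≡ 1ℚ + T
  suc-t≡ = trans (ℕ→ℚ-homo-+ 1 t) (cong (λ a → 1ℚ + a) T≡)

  m+k≡ : ℕ→ℚ (m ℕ.+ k) ≡ M + K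
  m+k≡ = trans (ℕ→ℚ-homo-+ m k) (cong₂ _+_ M≡ K≡)

  m+t≡ : ℕ→ℚ (m ℕ.+ t) ≡ M + T
  m+t≡ = trans (ℕ→ℚ-homo-+ m t) (cong₂ _+_ M≡ T≡)

  k+t≡ : ℕ→ℚ (k ℕ.+ t) ≡ K + T
  k+t≡ = trans (ℕ→ℚ-homo-+ k t) (cong₂ _+_ K≡ T≡)

  m+[1+t]≡ : ℕ→ℚ (m ℕ.+ suc t) ≡ M + (1ℚ + T)
  m+[1+t]≡ = trans (ℕ→ℚ-homo-+ m (suc t)) (cong₂ _+_ M≡ suc-t≡)

  2*m+t≡ : ℕ→ℚ (2 ℕ.* m ℕ.+ t) ≡ ℕ→ℚ 2 * M + T
  2*m+t≡ = trans (ℕ→ℚ-homo-+ (2 ℕ.* m) t) (cong₂ _+_ (trans (ℕ→ℚ-homo-* 2 m) (cong (ℕ→ℚ 2 *_) M≡)) T≡)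

  k-t≡ : ℤ→ℚ (+ k ℤ.- + t) ≡ K - T
  k-t≡ = trans (ℤ→ℚ-homo-- (+ k) (+ t)) (cong₂ _-_ K≡ T≡)

  k-[1+t]≡ : ℤ→ℚ (+ k ℤ.- + suc t) ≡ K - (1ℚ + T)
  k-[1+t]≡ = trans (ℤ→ℚ-homo-- (+ k) (+ suc t)) (cong₂ _-_ K≡ suc-t≡)

  t-1≡ : ℤ→ℚ (+ t ℤ.- 1ℤ) ≡ T - 1ℚ
  t-1≡ = trans (ℤ→ℚ-homo-- (+ t) 1ℤ) (cong (_- 1ℚ) T≡)

  indexᴬ : ℤ
  indexᴬ = (ℤ.+ 2) ℤ.* i ℤ.+ + m ℤ.- + k

  indexᴬ≡ : ℤ→ℚ indexᴬ ≡ ℤ→ℚ (ℤ.+ 2) * I + M - K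
  indexᴬ≡ = begin
    ℤ→ℚ indexᴬ                                     ≡⟨ ℤ→ℚ-homo-- ((ℤ.+ 2) ℤ.* i ℤ.+ + m) (+ k) ⟩
    ℤ→ℚ ((ℤ.+ 2) ℤ.* i ℤ.+ + m) - ℕ→ℚ k            ≡⟨ cong (_- ℕ→ℚ k) (ℤ→ℚ-homo-+ ((ℤ.+ 2) ℤ.* i) (+ m)) ⟩
    ℤ→ℚ ((ℤ.+ 2) ℤ.* i) + ℕ→ℚ m - ℕ→ℚ k            ≡⟨ cong (λ a → a + ℕ→ℚ m - ℕ→ℚ k) (ℤ→ℚ-homo-* (ℤ.+ 2) i) ⟩
    ℤ→ℚ (ℤ.+ 2) * ℤ→ℚ i + ℕ→ℚ m - ℕ→ℚ k            ≡⟨ cong₂ (λ a b → ℤ→ℚ (ℤ.+ 2) * a + b - ℕ→ℚ k) I≡ M≡ ⟩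
    ℤ→ℚ (ℤ.+ 2) * I + M - ℕ→ℚ k                    ≡⟨ cong (λ a → ℤ→ℚ (ℤ.+ 2) * I + M - a) K≡ ⟩
    ℤ→ℚ (ℤ.+ 2) * I + M - K                        ∎

  indexᴮ : ℤ
  indexᴮ = (ℤ.+ 2) ℤ.* + m ℤ.- (ℤ.+ 2) ℤ.* + k

  indexᴮ≡ : ℤ→ℚ indexᴮ ≡ ℤ→ℚ (ℤ.+ 2) * M - ℤ→ℚ (ℤ.+ 2) * K
  indexᴮ≡ = trans (ℤ→ℚ-homo-- ((ℤ.+ 2) ℤ.* + m) ((ℤ.+ 2) ℤ.* + k))
    (cong₂ _-_ (trans (ℤ→ℚ-homo-* (ℤ.+ 2) (+ m)) (cong (ℤ→ℚ (ℤ.+ 2) *_) M≡))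
               (trans (ℤ→ℚ-homo-* (ℤ.+ 2) (+ k)) (cong (ℤ→ℚ (ℤ.+ 2) *_) K≡)))

  indexᴬ⁻ : ℤ
  indexᴬ⁻ = (ℤ.+ 2) ℤ.* ℤ.pred i ℤ.+ + suc m ℤ.- + k

  indexᴬ≡indexᴬ⁻+1 : indexᴬ ≡ indexᴬ⁻ ℤ.+ 1ℤ
  indexᴬ≡indexᴬ⁻+1 = shift i (+ m) (+ k)
    where
    shift : ∀ i m k → (ℤ.+ 2) ℤ.* i ℤ.+ m ℤ.- k ≡ (ℤ.+ 2) ℤ.* (-1ℤ ℤ.+ i) ℤ.+ (1ℤ ℤ.+ m) ℤ.- k ℤ.+ 1ℤ
    shift = ℤ-Solver.solve-∀

  indexᴬ⁺≡indexᴬ+2 : (ℤ.+ 2) ℤ.* ℤ.suc i ℤ.+ + m ℤ.- + k ≡ indexᴬ ℤ.+ 1ℤ ℤ.+ 1ℤ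
  indexᴬ⁺≡indexᴬ+2 = shift i (+ m) (+ k)
    where
    shift : ∀ i m k → (ℤ.+ 2) ℤ.* (1ℤ ℤ.+ i) ℤ.+ m ℤ.- k ≡ (ℤ.+ 2) ℤ.* i ℤ.+ m ℤ.- k ℤ.+ 1ℤ ℤ.+ 1ℤ
    shift = ℤ-Solver.solve-∀

  indexᴮ⁺≡indexᴮ+2 : (ℤ.+ 2) ℤ.* + suc m ℤ.- (ℤ.+ 2) ℤ.* + k ≡ indexᴮ ℤ.+ 1ℤ ℤ.+ 1ℤ
  indexᴮ⁺≡indexᴮ+2 = shift (+ m) (+ k)
    where
    shift : ∀ m k → (ℤ.+ 2) ℤ.* (1ℤ ℤ.+ m) ℤ.- (ℤ.+ 2) ℤ.* k ≡ (ℤ.+ 2) ℤ.* m ℤ.- (ℤ.+ 2) ℤ.* k ℤ.+ 1ℤ ℤ.+ 1ℤ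
    shift = ℤ-Solver.solve-∀

  k-t≡k-[1+t]+1 : + k ℤ.- + t ≡ + k ℤ.- + suc t ℤ.+ 1ℤ
  k-t≡k-[1+t]+1 = shift (+ k) (+ t)
    where
    shift : ∀ a b → a ℤ.- b ≡ a ℤ.- (1ℤ ℤ.+ b) ℤ.+ 1ℤ
    shift = ℤ-Solver.solve-∀

  t≡t-1+1 : + t ≡ + t ℤ.- 1ℤ ℤ.+ 1ℤ
  t≡t-1+1 = shift (+ t)
    where
    shift : ∀ a → a ≡ a ℤ.- 1ℤ ℤ.+ 1ℤ
    shift = ℤ-Solver.solve-∀

  y+n+½∉ : ∀ n → NotNonPositiveInteger (y + ℕ→ℚ n + half)
  y+n+½∉ n = subst NotNonPositiveInteger (sym (ℚP.+-assoc y (ℕ→ℚ n) half))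
    (non-halfInteger+halfInteger⇒notNonPos y∉½ℤ (+ n , refl))

  y+a-k-½∉ : ∀ a → NotNonPositiveInteger (y + ℕ→ℚ a - ℕ→ℚ k - half)
  y+a-k-½∉ a = subst NotNonPositiveInteger y+[a-k-½]≡
    (non-halfInteger+halfInteger⇒notNonPos y∉½ℤ (halfInteger-ℤ-half (+ a ℤ.- + k)))
    where
    regroup : ∀ y a b → y + (a - b - half) ≡ y + a - b - half
    regroup = solve-∀ ℚ-ring
    y+[a-k-½]≡ : y + (ℤ→ℚ (+ a ℤ.- + k) - half) ≡ y + ℕ→ℚ a - ℕ→ℚ k - half
    y+[a-k-½]≡ = trans (cong (λ b → y + (b - half)) (ℤ→ℚ-homo-- (+ a) (+ k))) (regroup y (ℕ→ℚ a) (ℕ→ℚ k))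

  y-n-3/2∉ : ∀ n → NotNonPositiveInteger (y - ℕ→ℚ n - (+ 3) / 2)
  y-n-3/2∉ n = subst NotNonPositiveInteger y+[-n-1-½]≡
    (non-halfInteger+halfInteger⇒notNonPos y∉½ℤ (halfInteger-ℤ-half (ℤ.- + n ℤ.- 1ℤ)))
    where
    regroup : ∀ y a → y + (- a - 1ℚ - half) ≡ y - a - (+ 3) / 2
    regroup = solve-∀ ℚ-ring
    y+[-n-1-½]≡ : y + (ℤ→ℚ (ℤ.- + n ℤ.- 1ℤ) - half) ≡ y - ℕ→ℚ n - (+ 3) / 2
    y+[-n-1-½]≡ = trans
      (cong (λ b → y + (b - half)) (trans (ℤ→ℚ-homo-- (ℤ.- + n) 1ℤ) (cong (_- 1ℚ) (ℤ→ℚ-homo-neg (+ n)))))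
      (regroup y (ℕ→ℚ n))

  i-½∉ : NotNonPositiveInteger (ℤ→ℚ i - half)
  i-½∉ = halfInteger⇒notNonPos (halfInteger-ℤ-half i)

  A-at-i : ff (ℤ→ℚ i - half) indexᴬ ≡ (I - half) * A
  A-at-i = trans (ff-stepˡ indexᴬ⁻ i-½∉ indexᴬ≡indexᴬ⁻+1 shift (cong (_- half) I≡)) (cong ((I - half) *_) A≡)
    where
    shift : ℤ→ℚ i - half - 1ℚ ≡ ℤ→ℚ (ℤ.pred i) - half
    shift = begin
      ℤ→ℚ i - half - 1ℚ      ≡⟨ cong (λ a → a - half - 1ℚ) I≡ ⟩
      I - half - 1ℚ          ≡⟨ solve (I ∷ []) ℚ-ring ⟩
      - 1ℚ + I - half        ≡⟨ cong (_- half) pred-i≡ ⟨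
      ℤ→ℚ (ℤ.pred i) - half  ∎

  A-at-suc-i : ff (ℤ→ℚ (ℤ.suc i) - half) ((ℤ.+ 2) ℤ.* ℤ.suc i ℤ.+ + m ℤ.- + k)
               ≡ (I + half) * ((I - half) * A * (K - I - M - half))
  A-at-suc-i = begin
    ff (ℤ→ℚ (ℤ.suc i) - half) ((ℤ.+ 2) ℤ.* ℤ.suc i ℤ.+ + m ℤ.- + k)
      ≡⟨ ff-stepˡ (indexᴬ ℤ.+ 1ℤ) (halfInteger⇒notNonPos (halfInteger-ℤ-half (ℤ.suc i))) indexᴬ⁺≡indexᴬ+2 shift value ⟩
    (I + half) * ff (ℤ→ℚ i - half) (indexᴬ ℤ.+ 1ℤ)
      ≡⟨ cong ((I + half) *_) (ff-stepʳ indexᴬ (notNonPos⇒notNeg {ℤ→ℚ i - half} i-½∉) refl value′) ⟩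
    (I + half) * (ff (ℤ→ℚ i - half) indexᴬ * (K - I - M - half))
      ≡⟨ cong (λ a → (I + half) * (a * (K - I - M - half))) A-at-i ⟩
    (I + half) * ((I - half) * A * (K - I - M - half)) ∎
    where
    shift : ℤ→ℚ (ℤ.suc i) - half - 1ℚ ≡ ℤ→ℚ i - half
    shift = begin
      ℤ→ℚ (ℤ.suc i) - half - 1ℚ  ≡⟨ cong (λ a → a - half - 1ℚ) suc-i≡ ⟩
      1ℚ + I - half - 1ℚ         ≡⟨ solve (I ∷ []) ℚ-ring ⟩
      I - half                   ≡⟨ cong (_- half) I≡ ⟨
      ℤ→ℚ i - half               ∎
    value : ℤ→ℚ (ℤ.suc i) - half ≡ I + half
    value = begin
      ℤ→ℚ (ℤ.suc i) - half  ≡⟨ cong (_- half) suc-i≡ ⟩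
      1ℚ + I - half         ≡⟨ solve (I ∷ []) ℚ-ring ⟩
      I + half              ∎
    value′ : ℤ→ℚ i - half - ℤ→ℚ indexᴬ ≡ K - I - M - half
    value′ = begin
      ℤ→ℚ i - half - ℤ→ℚ indexᴬ             ≡⟨ cong₂ (λ a b → a - half - b) I≡ indexᴬ≡ ⟩
      I - half - (ℤ→ℚ (ℤ.+ 2) * I + M - K)  ≡⟨ solve (I ∷ M ∷ K ∷ []) ℚ-ring ⟩
      K - I - M - half                      ∎

  B-at-suc-m : ff (y + ℕ→ℚ (suc m) - ℕ→ℚ k - half) ((ℤ.+ 2) ℤ.* + suc m ℤ.- (ℤ.+ 2) ℤ.* + k)
               ≡ (y + M - K + half) * (B * (y - M + K - half))
  B-at-suc-m = begin
    ff (y + ℕ→ℚ (suc m) - ℕ→ℚ k - half) ((ℤ.+ 2) ℤ.* + suc m ℤ.- (ℤ.+ 2) ℤ.* + k)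
      ≡⟨ ff-stepˡ (indexᴮ ℤ.+ 1ℤ) (y+a-k-½∉ (suc m)) indexᴮ⁺≡indexᴮ+2 shift value ⟩
    (y + M - K + half) * ff (y + ℕ→ℚ m - ℕ→ℚ k - half) (indexᴮ ℤ.+ 1ℤ)
      ≡⟨ cong ((y + M - K + half) *_) (ff-stepʳ indexᴮ (notNonPos⇒notNeg {y + ℕ→ℚ m - ℕ→ℚ k - half} (y+a-k-½∉ m)) refl value′) ⟩
    (y + M - K + half) * (ff (y + ℕ→ℚ m - ℕ→ℚ k - half) indexᴮ * (y - M + K - half))
      ≡⟨ cong (λ b → (y + M - K + half) * (b * (y - M + K - half))) B≡ ⟩
    (y + M - K + half) * (B * (y - M + K - half)) ∎
    where
    shift : y + ℕ→ℚ (suc m) - ℕ→ℚ k - half - 1ℚ ≡ y + ℕ→ℚ m - ℕ→ℚ k - half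
    shift = begin
      y + ℕ→ℚ (suc m) - ℕ→ℚ k - half - 1ℚ  ≡⟨ cong₂ (λ a b → y + a - b - half - 1ℚ) suc-m≡ K≡ ⟩
      y + (1ℚ + M) - K - half - 1ℚ         ≡⟨ solve (y ∷ M ∷ K ∷ []) ℚ-ring ⟩
      y + M - K - half                     ≡⟨ cong₂ (λ a b → y + a - b - half) M≡ K≡ ⟨
      y + ℕ→ℚ m - ℕ→ℚ k - half             ∎
    value : y + ℕ→ℚ (suc m) - ℕ→ℚ k - half ≡ y + M - K + half
    value = begin
      y + ℕ→ℚ (suc m) - ℕ→ℚ k - half  ≡⟨ cong₂ (λ a b → y + a - b - half) suc-m≡ K≡ ⟩
      y + (1ℚ + M) - K - half         ≡⟨ solve (y ∷ M ∷ K ∷ []) ℚ-ring ⟩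
      y + M - K + half                ∎
    value′ : y + ℕ→ℚ m - ℕ→ℚ k - half - ℤ→ℚ indexᴮ ≡ y - M + K - half
    value′ = begin
      y + ℕ→ℚ m - ℕ→ℚ k - half - ℤ→ℚ indexᴮ                     ≡⟨ cong (λ c → y + ℕ→ℚ m - ℕ→ℚ k - half - c) indexᴮ≡ ⟩
      y + ℕ→ℚ m - ℕ→ℚ k - half - (ℤ→ℚ (ℤ.+ 2) * M - ℤ→ℚ (ℤ.+ 2) * K) ≡⟨ cong₂ (λ a b → y + a - b - half - (ℤ→ℚ (ℤ.+ 2) * M - ℤ→ℚ (ℤ.+ 2) * K)) M≡ K≡ ⟩
      y + M - K - half - (ℤ→ℚ (ℤ.+ 2) * M - ℤ→ℚ (ℤ.+ 2) * K)   ≡⟨ solve (y ∷ M ∷ K ∷ []) ℚ-ring ⟩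
      y - M + K - half                                          ∎

  P-at-t : ff (ℕ→ℚ (m ℕ.+ t)) (+ suc m) ≡ P * T
  P-at-t = cong₂ _*_ P≡ (begin
    ℕ→ℚ (m ℕ.+ t) - ℕ→ℚ m  ≡⟨ cong₂ _-_ m+t≡ M≡ ⟩
    M + T - M              ≡⟨ solve (M ∷ T ∷ []) ℚ-ring ⟩
    T                      ∎)

  P-step : ∀ a → ℕ→ℚ a ≡ M + (1ℚ + T) → ff (ℕ→ℚ a) (+ suc m) ≡ (M + T + 1ℚ) * P
  P-step a a≡ = begin
    ff (ℕ→ℚ a) (+ suc m)                      ≡⟨ risingDownProd-suc (ℕ→ℚ a) m ⟩
    ℕ→ℚ a * ff (ℕ→ℚ a - 1ℚ) (+ m)             ≡⟨ cong₂ (λ u v → u * ff v (+ m)) value shift ⟩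
    (M + T + 1ℚ) * ff (ℕ→ℚ (m ℕ.+ t)) (+ m)   ≡⟨ cong ((M + T + 1ℚ) *_) P≡ ⟩
    (M + T + 1ℚ) * P                          ∎
    where
    value : ℕ→ℚ a ≡ M + T + 1ℚ
    value = begin
      ℕ→ℚ a         ≡⟨ a≡ ⟩
      M + (1ℚ + T)  ≡⟨ solve (M ∷ T ∷ []) ℚ-ring ⟩
      M + T + 1ℚ    ∎
    shift : ℕ→ℚ a - 1ℚ ≡ ℕ→ℚ (m ℕ.+ t)
    shift = begin
      ℕ→ℚ a - 1ℚ          ≡⟨ cong (_- 1ℚ) a≡ ⟩
      M + (1ℚ + T) - 1ℚ   ≡⟨ solve (M ∷ T ∷ []) ℚ-ring ⟩
      M + T               ≡⟨ m+t≡ ⟨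
      ℕ→ℚ (m ℕ.+ t)       ∎

  P-at-suc-m : ff (ℕ→ℚ (suc m ℕ.+ t)) (+ suc m) ≡ (M + T + 1ℚ) * P
  P-at-suc-m = P-step (suc m ℕ.+ t) (trans (cong ℕ→ℚ (sym (ℕP.+-suc m t))) m+[1+t]≡)

  P-at-suc-t : ff (ℕ→ℚ (m ℕ.+ suc t)) (+ suc m) ≡ (M + T + 1ℚ) * P
  P-at-suc-t = P-step (m ℕ.+ suc t) m+[1+t]≡

  Q-at-suc-t : ff (ℕ→ℚ (k ℕ.+ suc t)) (+ (2 ℕ.* suc t)) ≡ (K + T + 1ℚ) * (Q * (K - T))
  Q-at-suc-t = begin
    risingDownProd (ℕ→ℚ (k ℕ.+ suc t)) (2 ℕ.* suc t)
      ≡⟨ cong (risingDownProd (ℕ→ℚ (k ℕ.+ suc t))) 2[1+t]≡2+2t ⟩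
    risingDownProd (ℕ→ℚ (k ℕ.+ suc t)) (suc (suc (2 ℕ.* t)))
      ≡⟨ risingDownProd-suc (ℕ→ℚ (k ℕ.+ suc t)) (suc (2 ℕ.* t)) ⟩
    ℕ→ℚ (k ℕ.+ suc t) * risingDownProd (ℕ→ℚ (k ℕ.+ suc t) - 1ℚ) (suc (2 ℕ.* t))
      ≡⟨ cong₂ (λ u v → u * risingDownProd v (suc (2 ℕ.* t))) value shift ⟩
    (K + T + 1ℚ) * (ff (ℕ→ℚ (k ℕ.+ t)) (+ (2 ℕ.* t)) * (ℕ→ℚ (k ℕ.+ t) - ℕ→ℚ (2 ℕ.* t)))
      ≡⟨ cong₂ (λ q d → (K + T + 1ℚ) * (q * d)) Q≡ difference ⟩
    (K + T + 1ℚ) * (Q * (K - T)) ∎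
    where
    2[1+t]≡2+2t : 2 ℕ.* suc t ≡ suc (suc (2 ℕ.* t))
    2[1+t]≡2+2t = cong suc (ℕP.+-suc t (t ℕ.+ 0))
    k+[1+t]≡ : ℕ→ℚ (k ℕ.+ suc t) ≡ K + (1ℚ + T)
    k+[1+t]≡ = trans (ℕ→ℚ-homo-+ k (suc t)) (cong₂ _+_ K≡ suc-t≡)
    value : ℕ→ℚ (k ℕ.+ suc t) ≡ K + T + 1ℚ
    value = begin
      ℕ→ℚ (k ℕ.+ suc t)  ≡⟨ k+[1+t]≡ ⟩
      K + (1ℚ + T)       ≡⟨ solve (K ∷ T ∷ []) ℚ-ring ⟩
      K + T + 1ℚ         ∎
    shift : ℕ→ℚ (k ℕ.+ suc t) - 1ℚ ≡ ℕ→ℚ (k ℕ.+ t)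
    shift = begin
      ℕ→ℚ (k ℕ.+ suc t) - 1ℚ  ≡⟨ cong (_- 1ℚ) k+[1+t]≡ ⟩
      K + (1ℚ + T) - 1ℚ       ≡⟨ solve (K ∷ T ∷ []) ℚ-ring ⟩
      K + T                   ≡⟨ k+t≡ ⟨
      ℕ→ℚ (k ℕ.+ t)           ∎
    difference : ℕ→ℚ (k ℕ.+ t) - ℕ→ℚ (2 ℕ.* t) ≡ K - T
    difference = begin
      ℕ→ℚ (k ℕ.+ t) - ℕ→ℚ (2 ℕ.* t)  ≡⟨ cong₂ _-_ k+t≡ (trans (ℕ→ℚ-homo-* 2 t) (cong (ℕ→ℚ 2 *_) T≡)) ⟩
      K + T - ℕ→ℚ 2 * T              ≡⟨ solve (K ∷ T ∷ []) ℚ-ring ⟩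
      K - T                          ∎

  X-at-i : ff (ℤ→ℚ i + ℕ→ℚ (2 ℕ.* m ℕ.+ t) + half) (+ t) ≡ X * (I + M + M + (+ 3) / 2)
  X-at-i = trans (ff-stepʳ (+ t ℤ.- 1ℤ) (notNonPos⇒notNeg {ℤ→ℚ i + ℕ→ℚ (2 ℕ.* m ℕ.+ t) + half}
                   (halfInteger⇒notNonPos (halfInteger-ℤ+ℕ+half i (2 ℕ.* m ℕ.+ t)))) t≡t-1+1 value)
                 (cong (_* (I + M + M + (+ 3) / 2)) X≡)
    where
    value : ℤ→ℚ i + ℕ→ℚ (2 ℕ.* m ℕ.+ t) + half - ℤ→ℚ (+ t ℤ.- 1ℤ) ≡ I + M + M + (+ 3) / 2
    value = begin
      ℤ→ℚ i + ℕ→ℚ (2 ℕ.* m ℕ.+ t) + half - ℤ→ℚ (+ t ℤ.- 1ℤ)  ≡⟨ cong₂ (λ a b → a + b + half - ℤ→ℚ (+ t ℤ.- 1ℤ)) I≡ 2*m+t≡ ⟩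
      I + (ℕ→ℚ 2 * M + T) + half - ℤ→ℚ (+ t ℤ.- 1ℤ)          ≡⟨ cong (λ c → I + (ℕ→ℚ 2 * M + T) + half - c) t-1≡ ⟩
      I + (ℕ→ℚ 2 * M + T) + half - (T - 1ℚ)                  ≡⟨ solve (I ∷ M ∷ T ∷ []) ℚ-ring ⟩
      I + M + M + (+ 3) / 2                                  ∎

  X-at-suc-i : ff (ℤ→ℚ (ℤ.suc i) + ℕ→ℚ (2 ℕ.* m ℕ.+ t) + half) (+ t) ≡ (I + M + M + T + (+ 3) / 2) * X
  X-at-suc-i = trans (ff-stepˡ (+ t ℤ.- 1ℤ) (halfInteger⇒notNonPos (halfInteger-ℤ+ℕ+half (ℤ.suc i) (2 ℕ.* m ℕ.+ t)))
                        t≡t-1+1 shift value)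
                     (cong ((I + M + M + T + (+ 3) / 2) *_) X≡)
    where
    shift : ℤ→ℚ (ℤ.suc i) + ℕ→ℚ (2 ℕ.* m ℕ.+ t) + half - 1ℚ ≡ ℤ→ℚ i + ℕ→ℚ (2 ℕ.* m ℕ.+ t) + half
    shift = begin
      ℤ→ℚ (ℤ.suc i) + ℕ→ℚ (2 ℕ.* m ℕ.+ t) + half - 1ℚ  ≡⟨ cong (λ a → a + ℕ→ℚ (2 ℕ.* m ℕ.+ t) + half - 1ℚ) suc-i≡ ⟩
      1ℚ + I + ℕ→ℚ (2 ℕ.* m ℕ.+ t) + half - 1ℚ         ≡⟨ cong (λ a → 1ℚ + I + a + half - 1ℚ) 2*m+t≡ ⟩
      1ℚ + I + (ℕ→ℚ 2 * M + T) + half - 1ℚ             ≡⟨ solve (I ∷ M ∷ T ∷ []) ℚ-ring ⟩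
      I + (ℕ→ℚ 2 * M + T) + half                       ≡⟨ cong₂ (λ a b → a + b + half) I≡ 2*m+t≡ ⟨
      ℤ→ℚ i + ℕ→ℚ (2 ℕ.* m ℕ.+ t) + half              ∎
    value : ℤ→ℚ (ℤ.suc i) + ℕ→ℚ (2 ℕ.* m ℕ.+ t) + half ≡ I + M + M + T + (+ 3) / 2
    value = begin
      ℤ→ℚ (ℤ.suc i) + ℕ→ℚ (2 ℕ.* m ℕ.+ t) + half  ≡⟨ cong₂ (λ a b → a + b + half) suc-i≡ 2*m+t≡ ⟩
      1ℚ + I + (ℕ→ℚ 2 * M + T) + half             ≡⟨ solve (I ∷ M ∷ T ∷ []) ℚ-ring ⟩
      I + M + M + T + (+ 3) / 2                   ∎

  X-at-pred-i : ff (ℤ→ℚ (ℤ.pred i) + ℕ→ℚ (2 ℕ.* suc m ℕ.+ t) + half) (+ t) ≡ (I + M + M + T + (+ 3) / 2) * X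
  X-at-pred-i = trans (cong (λ α → ff α (+ t)) same-argument) X-at-suc-i
    where
    2*[1+m]+t≡ : ℕ→ℚ (2 ℕ.* suc m ℕ.+ t) ≡ ℕ→ℚ 2 * (1ℚ + M) + T
    2*[1+m]+t≡ = trans (ℕ→ℚ-homo-+ (2 ℕ.* suc m) t) (cong₂ _+_ (trans (ℕ→ℚ-homo-* 2 (suc m)) (cong (ℕ→ℚ 2 *_) suc-m≡)) T≡)
    same-argument : ℤ→ℚ (ℤ.pred i) + ℕ→ℚ (2 ℕ.* suc m ℕ.+ t) + half ≡ ℤ→ℚ (ℤ.suc i) + ℕ→ℚ (2 ℕ.* m ℕ.+ t) + half
    same-argument = begin
      ℤ→ℚ (ℤ.pred i) + ℕ→ℚ (2 ℕ.* suc m ℕ.+ t) + half  ≡⟨ cong₂ (λ a b → a + b + half) pred-i≡ 2*[1+m]+t≡ ⟩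
      - 1ℚ + I + (ℕ→ℚ 2 * (1ℚ + M) + T) + half        ≡⟨ solve (I ∷ M ∷ T ∷ []) ℚ-ring ⟩
      1ℚ + I + (ℕ→ℚ 2 * M + T) + half                 ≡⟨ cong₂ (λ a b → a + b + half) suc-i≡ 2*m+t≡ ⟨
      ℤ→ℚ (ℤ.suc i) + ℕ→ℚ (2 ℕ.* m ℕ.+ t) + half      ∎

  X-at-suc-t : ff (ℤ→ℚ i + ℕ→ℚ (2 ℕ.* m ℕ.+ suc t) + half) (+ suc t ℤ.- ℤ.+ 1) ≡ (I + M + M + T + (+ 3) / 2) * X
  X-at-suc-t = trans (cong₂ ff same-argument (shift (+ t))) X-at-suc-i
    where
    shift : ∀ a → 1ℤ ℤ.+ a ℤ.- 1ℤ ≡ a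
    shift = ℤ-Solver.solve-∀
    2*m+[1+t]≡ : ℕ→ℚ (2 ℕ.* m ℕ.+ suc t) ≡ ℕ→ℚ 2 * M + (1ℚ + T)
    2*m+[1+t]≡ = trans (ℕ→ℚ-homo-+ (2 ℕ.* m) (suc t)) (cong₂ _+_ (trans (ℕ→ℚ-homo-* 2 m) (cong (ℕ→ℚ 2 *_) M≡)) suc-t≡)
    same-argument : ℤ→ℚ i + ℕ→ℚ (2 ℕ.* m ℕ.+ suc t) + half ≡ ℤ→ℚ (ℤ.suc i) + ℕ→ℚ (2 ℕ.* m ℕ.+ t) + half
    same-argument = begin
      ℤ→ℚ i + ℕ→ℚ (2 ℕ.* m ℕ.+ suc t) + half      ≡⟨ cong₂ (λ a b → a + b + half) I≡ 2*m+[1+t]≡ ⟩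
      I + (ℕ→ℚ 2 * M + (1ℚ + T)) + half          ≡⟨ solve (I ∷ M ∷ T ∷ []) ℚ-ring ⟩
      1ℚ + I + (ℕ→ℚ 2 * M + T) + half            ≡⟨ cong₂ (λ a b → a + b + half) suc-i≡ 2*m+t≡ ⟨
      ℤ→ℚ (ℤ.suc i) + ℕ→ℚ (2 ℕ.* m ℕ.+ t) + half  ∎

  Y-at-i : ff (ℤ→ℚ i + ℕ→ℚ (m ℕ.+ k) + half) (+ k ℤ.- + t) ≡ Y * (I + M + T + (+ 3) / 2)
  Y-at-i = trans (ff-stepʳ (+ k ℤ.- + suc t) (notNonPos⇒notNeg {ℤ→ℚ i + ℕ→ℚ (m ℕ.+ k) + half}
                   (halfInteger⇒notNonPos (halfInteger-ℤ+ℕ+half i (m ℕ.+ k)))) k-t≡k-[1+t]+1 value)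
                 (cong (_* (I + M + T + (+ 3) / 2)) Y≡)
    where
    value : ℤ→ℚ i + ℕ→ℚ (m ℕ.+ k) + half - ℤ→ℚ (+ k ℤ.- + suc t) ≡ I + M + T + (+ 3) / 2
    value = begin
      ℤ→ℚ i + ℕ→ℚ (m ℕ.+ k) + half - ℤ→ℚ (+ k ℤ.- + suc t)  ≡⟨ cong₂ (λ a b → a + b + half - ℤ→ℚ (+ k ℤ.- + suc t)) I≡ m+k≡ ⟩
      I + (M + K) + half - ℤ→ℚ (+ k ℤ.- + suc t)            ≡⟨ cong (λ c → I + (M + K) + half - c) k-[1+t]≡ ⟩
      I + (M + K) + half - (K - (1ℚ + T))                   ≡⟨ solve (I ∷ M ∷ K ∷ T ∷ []) ℚ-ring ⟩
      I + M + T + (+ 3) / 2                                 ∎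

  Y-at-suc-i : ff (ℤ→ℚ (ℤ.suc i) + ℕ→ℚ (m ℕ.+ k) + half) (+ k ℤ.- + t) ≡ (I + M + K + (+ 3) / 2) * Y
  Y-at-suc-i = trans (ff-stepˡ (+ k ℤ.- + suc t) (halfInteger⇒notNonPos (halfInteger-ℤ+ℕ+half (ℤ.suc i) (m ℕ.+ k)))
                        k-t≡k-[1+t]+1 shift value)
                     (cong ((I + M + K + (+ 3) / 2) *_) Y≡)
    where
    shift : ℤ→ℚ (ℤ.suc i) + ℕ→ℚ (m ℕ.+ k) + half - 1ℚ ≡ ℤ→ℚ i + ℕ→ℚ (m ℕ.+ k) + half
    shift = begin
      ℤ→ℚ (ℤ.suc i) + ℕ→ℚ (m ℕ.+ k) + half - 1ℚ  ≡⟨ cong (λ a → a + ℕ→ℚ (m ℕ.+ k) + half - 1ℚ) suc-i≡ ⟩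
      1ℚ + I + ℕ→ℚ (m ℕ.+ k) + half - 1ℚ         ≡⟨ cong (λ a → 1ℚ + I + a + half - 1ℚ) m+k≡ ⟩
      1ℚ + I + (M + K) + half - 1ℚ               ≡⟨ solve (I ∷ M ∷ K ∷ []) ℚ-ring ⟩
      I + (M + K) + half                         ≡⟨ cong₂ (λ a b → a + b + half) I≡ m+k≡ ⟨
      ℤ→ℚ i + ℕ→ℚ (m ℕ.+ k) + half              ∎
    value : ℤ→ℚ (ℤ.suc i) + ℕ→ℚ (m ℕ.+ k) + half ≡ I + M + K + (+ 3) / 2
    value = begin
      ℤ→ℚ (ℤ.suc i) + ℕ→ℚ (m ℕ.+ k) + half  ≡⟨ cong₂ (λ a b → a + b + half) suc-i≡ m+k≡ ⟩
      1ℚ + I + (M + K) + half               ≡⟨ solve (I ∷ M ∷ K ∷ []) ℚ-ring ⟩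
      I + M + K + (+ 3) / 2                 ∎

  Y-at-pred-i : ff (ℤ→ℚ (ℤ.pred i) + ℕ→ℚ (suc m ℕ.+ k) + half) (+ k ℤ.- + t) ≡ Y * (I + M + T + (+ 3) / 2)
  Y-at-pred-i = trans (cong (λ α → ff α (+ k ℤ.- + t)) same-argument) Y-at-i
    where
    same-argument : ℤ→ℚ (ℤ.pred i) + ℕ→ℚ (suc m ℕ.+ k) + half ≡ ℤ→ℚ i + ℕ→ℚ (m ℕ.+ k) + half
    same-argument = begin
      ℤ→ℚ (ℤ.pred i) + ℕ→ℚ (suc m ℕ.+ k) + half  ≡⟨ cong₂ (λ a b → a + b + half) pred-i≡ (ℕ→ℚ-homo-+ 1 (m ℕ.+ k)) ⟩
      - 1ℚ + I + (1ℚ + ℕ→ℚ (m ℕ.+ k)) + half     ≡⟨ cong (λ a → - 1ℚ + I + (1ℚ + a) + half) m+k≡ ⟩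
      - 1ℚ + I + (1ℚ + (M + K)) + half           ≡⟨ solve (I ∷ M ∷ K ∷ []) ℚ-ring ⟩
      I + (M + K) + half                         ≡⟨ cong₂ (λ a b → a + b + half) I≡ m+k≡ ⟨
      ℤ→ℚ i + ℕ→ℚ (m ℕ.+ k) + half              ∎

  Z-at-t : ff (y + ℕ→ℚ (m ℕ.+ k) + half) (+ k ℤ.- + t) ≡ Z * (y + M + T + (+ 3) / 2)
  Z-at-t = trans (ff-stepʳ (+ k ℤ.- + suc t) (notNonPos⇒notNeg {y + ℕ→ℚ (m ℕ.+ k) + half} (y+n+½∉ (m ℕ.+ k)))
                   k-t≡k-[1+t]+1 value)
                 (cong (_* (y + M + T + (+ 3) / 2)) Z≡)
    where
    value : y + ℕ→ℚ (m ℕ.+ k) + half - ℤ→ℚ (+ k ℤ.- + suc t) ≡ y + M + T + (+ 3) / 2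
    value = begin
      y + ℕ→ℚ (m ℕ.+ k) + half - ℤ→ℚ (+ k ℤ.- + suc t)  ≡⟨ cong₂ (λ a b → y + a + half - b) m+k≡ k-[1+t]≡ ⟩
      y + (M + K) + half - (K - (1ℚ + T))               ≡⟨ solve (y ∷ M ∷ K ∷ T ∷ []) ℚ-ring ⟩
      y + M + T + (+ 3) / 2                             ∎

  Z-at-suc-m : ff (y + ℕ→ℚ (suc m ℕ.+ k) + half) (+ k ℤ.- + t) ≡ (y + M + K + (+ 3) / 2) * Z
  Z-at-suc-m = trans (ff-stepˡ (+ k ℤ.- + suc t) (y+n+½∉ (suc m ℕ.+ k)) k-t≡k-[1+t]+1 shift value)
                     (cong ((y + M + K + (+ 3) / 2) *_) Z≡)
    where
    1+m+k≡ : ℕ→ℚ (suc m ℕ.+ k) ≡ 1ℚ + (M + K)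
    1+m+k≡ = trans (ℕ→ℚ-homo-+ 1 (m ℕ.+ k)) (cong (λ a → 1ℚ + a) m+k≡)
    shift : y + ℕ→ℚ (suc m ℕ.+ k) + half - 1ℚ ≡ y + ℕ→ℚ (m ℕ.+ k) + half
    shift = begin
      y + ℕ→ℚ (suc m ℕ.+ k) + half - 1ℚ  ≡⟨ cong (λ a → y + a + half - 1ℚ) 1+m+k≡ ⟩
      y + (1ℚ + (M + K)) + half - 1ℚ     ≡⟨ solve (y ∷ M ∷ K ∷ []) ℚ-ring ⟩
      y + (M + K) + half                 ≡⟨ cong (λ a → y + a + half) m+k≡ ⟨
      y + ℕ→ℚ (m ℕ.+ k) + half           ∎
    value : y + ℕ→ℚ (suc m ℕ.+ k) + half ≡ y + M + K + (+ 3) / 2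
    value = begin
      y + ℕ→ℚ (suc m ℕ.+ k) + half  ≡⟨ cong (λ a → y + a + half) 1+m+k≡ ⟩
      y + (1ℚ + (M + K)) + half     ≡⟨ solve (y ∷ M ∷ K ∷ []) ℚ-ring ⟩
      y + M + K + (+ 3) / 2         ∎

  V-at-t : ff (y - ℕ→ℚ (m ℕ.+ t) - (+ 3) / 2) (+ k ℤ.- + t) ≡ (y - M - T - (+ 3) / 2) * V
  V-at-t = trans (ff-stepˡ (+ k ℤ.- + suc t) (y-n-3/2∉ (m ℕ.+ t)) k-t≡k-[1+t]+1 shift value)
                 (cong ((y - M - T - (+ 3) / 2) *_) V≡)
    where
    shift : y - ℕ→ℚ (m ℕ.+ t) - (+ 3) / 2 - 1ℚ ≡ y - ℕ→ℚ (m ℕ.+ suc t) - (+ 3) / 2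
    shift = begin
      y - ℕ→ℚ (m ℕ.+ t) - (+ 3) / 2 - 1ℚ  ≡⟨ cong (λ a → y - a - (+ 3) / 2 - 1ℚ) m+t≡ ⟩
      y - (M + T) - (+ 3) / 2 - 1ℚ        ≡⟨ solve (y ∷ M ∷ T ∷ []) ℚ-ring ⟩
      y - (M + (1ℚ + T)) - (+ 3) / 2      ≡⟨ cong (λ a → y - a - (+ 3) / 2) m+[1+t]≡ ⟨
      y - ℕ→ℚ (m ℕ.+ suc t) - (+ 3) / 2   ∎
    value : y - ℕ→ℚ (m ℕ.+ t) - (+ 3) / 2 ≡ y - M - T - (+ 3) / 2
    value = begin
      y - ℕ→ℚ (m ℕ.+ t) - (+ 3) / 2  ≡⟨ cong (λ a → y - a - (+ 3) / 2) m+t≡ ⟩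
      y - (M + T) - (+ 3) / 2        ≡⟨ solve (y ∷ M ∷ T ∷ []) ℚ-ring ⟩
      y - M - T - (+ 3) / 2          ∎

  V-at-suc-m : ff (y - ℕ→ℚ (suc m ℕ.+ t) - (+ 3) / 2) (+ k ℤ.- + t) ≡ V * (y - M - K - (+ 3) / 2)
  V-at-suc-m = begin
    ff (y - ℕ→ℚ (suc m ℕ.+ t) - (+ 3) / 2) (+ k ℤ.- + t)
      ≡⟨ cong (λ n → ff (y - ℕ→ℚ n - (+ 3) / 2) (+ k ℤ.- + t)) (ℕP.+-suc m t) ⟨
    ff (y - ℕ→ℚ (m ℕ.+ suc t) - (+ 3) / 2) (+ k ℤ.- + t)
      ≡⟨ ff-stepʳ (+ k ℤ.- + suc t) (notNonPos⇒notNeg {y - ℕ→ℚ (m ℕ.+ suc t) - (+ 3) / 2} (y-n-3/2∉ (m ℕ.+ suc t)))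
           k-t≡k-[1+t]+1 value ⟩
    ff (y - ℕ→ℚ (m ℕ.+ suc t) - (+ 3) / 2) (+ k ℤ.- + suc t) * (y - M - K - (+ 3) / 2)
      ≡⟨ cong (_* (y - M - K - (+ 3) / 2)) V≡ ⟩
    V * (y - M - K - (+ 3) / 2) ∎
    where
    value : y - ℕ→ℚ (m ℕ.+ suc t) - (+ 3) / 2 - ℤ→ℚ (+ k ℤ.- + suc t) ≡ y - M - K - (+ 3) / 2
    value = begin
      y - ℕ→ℚ (m ℕ.+ suc t) - (+ 3) / 2 - ℤ→ℚ (+ k ℤ.- + suc t)  ≡⟨ cong₂ (λ a b → y - a - (+ 3) / 2 - b) m+[1+t]≡ k-[1+t]≡ ⟩
      y - (M + (1ℚ + T)) - (+ 3) / 2 - (K - (1ℚ + T))            ≡⟨ solve (y ∷ M ∷ K ∷ T ∷ []) ℚ-ring ⟩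
      y - M - K - (+ 3) / 2                                      ∎

  Π : ℚ
  Π = A * B * P * Q * X * Y * Z * V

  c : ℚ
  c = (K + half) * (K + half) + y * y - (I + M + 1ℚ) * (I + M + 1ℚ) - I * I

  g₀ g₁ g₂ r₀ r₁ : ℚ
  g₀ = (I - half) * (I + M + M + (+ 3) / 2) * (I + M + T + (+ 3) / 2) * (y + M + T + (+ 3) / 2) * (y - M - T - (+ 3) / 2)
  g₁ = (I + half) * (I - half) * (K - I - M - half) * (I + M + M + T + (+ 3) / 2)
       * (I + M + K + (+ 3) / 2) * (y + M + T + (+ 3) / 2) * (y - M - T - (+ 3) / 2)
  g₂ = (y + M - K + half) * (y - M + K - half) * (M + T + 1ℚ) * (I + M + M + T + (+ 3) / 2)
       * (I + M + T + (+ 3) / 2) * (y + M + K + (+ 3) / 2) * (y - M - K - (+ 3) / 2)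
  r₀ = T * (I - half) * (I + M + T + (+ 3) / 2) * (y + M + T + (+ 3) / 2) * (y - M - T - (+ 3) / 2)
       * ((y * y - I * I) * (I + M + M + M + T + (+ 5) / 2) + (I + M + T + half) * (I + M - K + half) * (I + M + K + (+ 3) / 2))
  r₁ = (M + T + 1ℚ) * (K + T + 1ℚ) * (K - T) * (I - half) * (I + M + M + T + (+ 3) / 2)
       * ((y * y - I * I) * (I + M + M + M + T + (+ 7) / 2) + (I + M + T + (+ 3) / 2) * (I + M - K + half) * (I + M + K + (+ 3) / 2))

  bracket-at : ∀ L {Λ} → ℕ→ℚ L ≡ Λ →
    (y * y - ℤ→ℚ i * ℤ→ℚ i) * (ℤ→ℚ i + ℕ→ℚ (3 ℕ.* m ℕ.+ L) + (+ 5) / 2)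
      + (ℤ→ℚ i + ℕ→ℚ (m ℕ.+ L) + half) * (ℤ→ℚ i + ℕ→ℚ m - ℕ→ℚ k + half) * (ℤ→ℚ i + ℕ→ℚ (m ℕ.+ k) + (+ 3) / 2)
    ≡ (y * y - I * I) * (I + M + M + M + Λ + (+ 5) / 2) + (I + M + Λ + half) * (I + M - K + half) * (I + M + K + (+ 3) / 2)
  bracket-at L {Λ} L≡ = begin
    shape (ℤ→ℚ i) (ℕ→ℚ (3 ℕ.* m ℕ.+ L)) (ℕ→ℚ (m ℕ.+ L)) (ℕ→ℚ m) (ℕ→ℚ k) (ℕ→ℚ (m ℕ.+ k))
      ≡⟨ cong-shape I≡ 3*m+L≡ (trans (ℕ→ℚ-homo-+ m L) (cong₂ _+_ M≡ L≡)) M≡ K≡ m+k≡ ⟩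
    (y * y - I * I) * (I + (ℕ→ℚ 3 * M + Λ) + (+ 5) / 2) + (I + (M + Λ) + half) * (I + M - K + half) * (I + (M + K) + (+ 3) / 2)
      ≡⟨ solve (y ∷ I ∷ M ∷ K ∷ Λ ∷ []) ℚ-ring ⟩
    (y * y - I * I) * (I + M + M + M + Λ + (+ 5) / 2) + (I + M + Λ + half) * (I + M - K + half) * (I + M + K + (+ 3) / 2) ∎
    where
    shape : ℚ → ℚ → ℚ → ℚ → ℚ → ℚ → ℚ
    shape a b c d e f = (y * y - a * a) * (a + b + (+ 5) / 2) + (a + c + half) * (a + d - e + half) * (a + f + (+ 3) / 2)
    cong-shape : ∀ {a a′ b b′ c c′ d d′ e e′ f f′} → a ≡ a′ → b ≡ b′ → c ≡ c′ → d ≡ d′ → e ≡ e′ → f ≡ f′ →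
                 shape a b c d e f ≡ shape a′ b′ c′ d′ e′ f′
    cong-shape refl refl refl refl refl refl = refl
    3*m+L≡ : ℕ→ℚ (3 ℕ.* m ℕ.+ L) ≡ ℕ→ℚ 3 * M + Λ
    3*m+L≡ = trans (ℕ→ℚ-homo-+ (3 ℕ.* m) L) (cong₂ _+_ (trans (ℕ→ℚ-homo-* 3 m) (cong (ℕ→ℚ 3 *_) M≡)) L≡)

  w[M+1]≡1 : w * (M + 1ℚ) ≡ 1ℚ
  w[M+1]≡1 = begin
    w * (M + 1ℚ)                     ≡⟨ cong₂ _*_ w≡ (trans suc-m≡ (ℚP.+-comm 1ℚ M)) ⟨
    inv (ℕ→ℚ (suc m)) * ℕ→ℚ (suc m)  ≡⟨ inv-inverseˡ (ℕ→ℚ-suc≢0 m) ⟩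
    1ℚ                               ∎

  middle-coefficient≡ : N-middle-coefficient y i m k ≡ c
  middle-coefficient≡ = begin
    (ℕ→ℚ k + half) * (ℕ→ℚ k + half) + y * y - (ℤ→ℚ i + ℕ→ℚ (suc m)) * (ℤ→ℚ i + ℕ→ℚ (suc m)) - ℤ→ℚ i * ℤ→ℚ i
      ≡⟨ cong₂ (λ a b → (ℕ→ℚ k + half) * (ℕ→ℚ k + half) + y * y - (a + b) * (a + b) - a * a) I≡ suc-m≡ ⟩
    (ℕ→ℚ k + half) * (ℕ→ℚ k + half) + y * y - (I + (1ℚ + M)) * (I + (1ℚ + M)) - I * I
      ≡⟨ cong (λ c → (c + half) * (c + half) + y * y - (I + (1ℚ + M)) * (I + (1ℚ + M)) - I * I) K≡ ⟩
    (K + half) * (K + half) + y * y - (I + (1ℚ + M)) * (I + (1ℚ + M)) - I * I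
      ≡⟨ solve (y ∷ I ∷ M ∷ K ∷ []) ℚ-ring ⟩
    (K + half) * (K + half) + y * y - (I + M + 1ℚ) * (I + M + 1ℚ) - I * I ∎

  last-coefficient≡ : N-last-coefficient i m ≡ w * (I - half)
  last-coefficient≡ = begin
    ℤ→ℚ ((ℤ.+ 2) ℤ.* i ℤ.- ℤ.+ 1) * inv (ℕ→ℚ (2 ℕ.* m ℕ.+ 2))  ≡⟨ cong₂ _*_ numerator denominator ⟩
    (ℤ→ℚ (ℤ.+ 2) * I - 1ℚ) * (w * half)                       ≡⟨ solve (I ∷ w ∷ []) ℚ-ring ⟩
    w * (I - half)                                            ∎
    where
    numerator : ℤ→ℚ ((ℤ.+ 2) ℤ.* i ℤ.- ℤ.+ 1) ≡ ℤ→ℚ (ℤ.+ 2) * I - 1ℚ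
    numerator = trans (ℤ→ℚ-homo-- ((ℤ.+ 2) ℤ.* i) 1ℤ)
                      (cong (_- 1ℚ) (trans (ℤ→ℚ-homo-* (ℤ.+ 2) i) (cong (ℤ→ℚ (ℤ.+ 2) *_) I≡)))
    2*m+2≡[1+m]*2 : ∀ m → 2 ℕ.* m ℕ.+ 2 ≡ (1 ℕ.+ m) ℕ.* 2
    2*m+2≡[1+m]*2 = ℕ-Solver.solve-∀
    denominator : inv (ℕ→ℚ (2 ℕ.* m ℕ.+ 2)) ≡ w * half
    denominator = begin
      inv (ℕ→ℚ (2 ℕ.* m ℕ.+ 2))            ≡⟨ cong inv (trans (cong ℕ→ℚ (2*m+2≡[1+m]*2 m)) (ℕ→ℚ-homo-* (suc m) 2)) ⟩
      inv (ℕ→ℚ (suc m) * ℕ→ℚ 2)            ≡⟨ inv-distrib-* (ℕ→ℚ-suc≢0 m) (ℕ→ℚ-suc≢0 1) ⟩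
      inv (ℕ→ℚ (suc m)) * inv (ℕ→ℚ 2)      ≡⟨ cong (_* inv (ℕ→ℚ 2)) w≡ ⟩
      w * half                             ∎

  G-at-i : G y i m k t ≡ - (Π * g₀)
  G-at-i = cong -_ (begin
    _ ≡⟨ *-cong₈ A-at-i B≡ P≡ Q≡ X-at-i Y-at-i Z-at-t V-at-t ⟩
    (I - half) * A * B * P * Q * (X * (I + M + M + (+ 3) / 2)) * (Y * (I + M + T + (+ 3) / 2))
      * (Z * (y + M + T + (+ 3) / 2)) * ((y - M - T - (+ 3) / 2) * V)
      ≡⟨ solve (y ∷ I ∷ M ∷ T ∷ A ∷ B ∷ P ∷ Q ∷ X ∷ Y ∷ Z ∷ V ∷ []) ℚ-ring ⟩
    A * B * P * Q * X * Y * Z * V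
      * ((I - half) * (I + M + M + (+ 3) / 2) * (I + M + T + (+ 3) / 2) * (y + M + T + (+ 3) / 2) * (y - M - T - (+ 3) / 2)) ∎)

  G-at-suc-i : G y (ℤ.suc i) m k t ≡ - (Π * g₁)
  G-at-suc-i = cong -_ (begin
    _ ≡⟨ *-cong₈ A-at-suc-i B≡ P≡ Q≡ X-at-suc-i Y-at-suc-i Z-at-t V-at-t ⟩
    (I + half) * ((I - half) * A * (K - I - M - half)) * B * P * Q * ((I + M + M + T + (+ 3) / 2) * X)
      * ((I + M + K + (+ 3) / 2) * Y) * (Z * (y + M + T + (+ 3) / 2)) * ((y - M - T - (+ 3) / 2) * V)
      ≡⟨ solve (y ∷ I ∷ M ∷ T ∷ K ∷ A ∷ B ∷ P ∷ Q ∷ X ∷ Y ∷ Z ∷ V ∷ []) ℚ-ring ⟩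
    A * B * P * Q * X * Y * Z * V
      * ((I + half) * (I - half) * (K - I - M - half) * (I + M + M + T + (+ 3) / 2)
         * (I + M + K + (+ 3) / 2) * (y + M + T + (+ 3) / 2) * (y - M - T - (+ 3) / 2)) ∎)

  G-at-pred-i : G y (ℤ.pred i) (suc m) k t ≡ - (Π * g₂)
  G-at-pred-i = cong -_ (begin
    _ ≡⟨ *-cong₈ A≡ B-at-suc-m P-at-suc-m Q≡ X-at-pred-i Y-at-pred-i Z-at-suc-m V-at-suc-m ⟩
    A * ((y + M - K + half) * (B * (y - M + K - half))) * ((M + T + 1ℚ) * P) * Q * ((I + M + M + T + (+ 3) / 2) * X)
      * (Y * (I + M + T + (+ 3) / 2)) * ((y + M + K + (+ 3) / 2) * Z) * (V * (y - M - K - (+ 3) / 2))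
      ≡⟨ solve (y ∷ I ∷ M ∷ T ∷ K ∷ A ∷ B ∷ P ∷ Q ∷ X ∷ Y ∷ Z ∷ V ∷ []) ℚ-ring ⟩
    A * B * P * Q * X * Y * Z * V
      * ((y + M - K + half) * (y - M + K - half) * (M + T + 1ℚ) * (I + M + M + T + (+ 3) / 2)
         * (I + M + T + (+ 3) / 2) * (y + M + K + (+ 3) / 2) * (y - M - K - (+ 3) / 2)) ∎)

  RHS-at-t : RHS y i m k t ≡ w * Π * r₀
  RHS-at-t = begin
    _ ≡⟨ *-cong₁₀ P-at-t w≡ Q≡ A-at-i Y-at-i X≡ Z-at-t B≡ V-at-t (bracket-at t T≡) ⟩
    P * T * w * Q * ((I - half) * A) * (Y * (I + M + T + (+ 3) / 2)) * X * (Z * (y + M + T + (+ 3) / 2)) * B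
      * ((y - M - T - (+ 3) / 2) * V)
      * ((y * y - I * I) * (I + M + M + M + T + (+ 5) / 2) + (I + M + T + half) * (I + M - K + half) * (I + M + K + (+ 3) / 2))
      ≡⟨ solve (y ∷ I ∷ M ∷ T ∷ K ∷ w ∷ A ∷ B ∷ P ∷ Q ∷ X ∷ Y ∷ Z ∷ V ∷ []) ℚ-ring ⟩
    w * (A * B * P * Q * X * Y * Z * V)
      * (T * (I - half) * (I + M + T + (+ 3) / 2) * (y + M + T + (+ 3) / 2) * (y - M - T - (+ 3) / 2)
         * ((y * y - I * I) * (I + M + M + M + T + (+ 5) / 2) + (I + M + T + half) * (I + M - K + half) * (I + M + K + (+ 3) / 2))) ∎

  RHS-at-suc-t : RHS y i m k (suc t) ≡ w * Π * r₁
  RHS-at-suc-t = begin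
    _ ≡⟨ *-cong₁₀ P-at-suc-t w≡ Q-at-suc-t A-at-i Y≡ X-at-suc-t Z≡ B≡ V≡ (bracket-at (suc t) suc-t≡) ⟩
    (M + T + 1ℚ) * P * w * ((K + T + 1ℚ) * (Q * (K - T))) * ((I - half) * A) * Y * ((I + M + M + T + (+ 3) / 2) * X)
      * Z * B * V
      * ((y * y - I * I) * (I + M + M + M + (1ℚ + T) + (+ 5) / 2) + (I + M + (1ℚ + T) + half) * (I + M - K + half) * (I + M + K + (+ 3) / 2))
      ≡⟨ solve (y ∷ I ∷ M ∷ T ∷ K ∷ w ∷ A ∷ B ∷ P ∷ Q ∷ X ∷ Y ∷ Z ∷ V ∷ []) ℚ-ring ⟩
    w * (A * B * P * Q * X * Y * Z * V)
      * ((M + T + 1ℚ) * (K + T + 1ℚ) * (K - T) * (I - half) * (I + M + M + T + (+ 3) / 2)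
         * ((y * y - I * I) * (I + M + M + M + T + (+ 7) / 2) + (I + M + T + (+ 3) / 2) * (I + M - K + half) * (I + M + K + (+ 3) / 2))) ∎

  summand-telescopes : N-summand y i m k t ≡ RHS y i m k t - RHS y i m k (suc t)
  summand-telescopes = begin
    N-summand y i m k t
      ≡⟨ cong₂ _-_ (cong₂ _+_ (cong (- ((+ 2) / 1) *_) G-at-suc-i) (cong₂ _*_ middle-coefficient≡ G-at-i))
                   (cong₂ _*_ last-coefficient≡ G-at-pred-i) ⟩
    - ((+ 2) / 1) * - (Π * g₁) + c * - (Π * g₀) - w * (I - half) * - (Π * g₂)
      ≡⟨ clear-denominator Π {w} {M} {I - half} {c} {g₁} {g₀} {g₂} {r₀} {r₁} w[M+1]≡1 (summand-identity y I M T K) ⟩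
    w * Π * r₀ - w * Π * r₁
      ≡⟨ cong₂ _-_ RHS-at-t RHS-at-suc-t ⟨
    RHS y i m k t - RHS y i m k (suc t) ∎

N-summand-telescopes : ∀ {y} → ¬ HalfInteger y → ∀ i m k t → N-summand y i m k t ≡ RHS y i m k t - RHS y i m k (suc t)
N-summand-telescopes y∉½ℤ i m k t =
  Summand.summand-telescopes y∉½ℤ {i} {m} {k} {t} refl refl refl refl refl refl refl refl refl refl refl refl refl

-- The factors are spelled out: unification cannot invert ℚ's _*_, which matches on its arguments.
RHS-vanishes : ∀ y i m k L → k < L → RHS y i m k L ≡ 0ℚ
RHS-vanishes y i m k L k<L = *-zero₃
  (ff (ℕ→ℚ (m ℕ.+ L)) (+ suc m)) (inv (ℕ→ℚ (suc m)))
  (ff (ℤ→ℚ i - half) ((ℤ.+ 2) ℤ.* i ℤ.+ + m ℤ.- + k))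
  (ff (ℤ→ℚ i + ℕ→ℚ (m ℕ.+ k) + half) (+ k ℤ.- + L))
  (ff (ℤ→ℚ i + ℕ→ℚ (2 ℕ.* m ℕ.+ L) + half) (+ L ℤ.- ℤ.+ 1))
  (ff (y + ℕ→ℚ (m ℕ.+ k) + half) (+ k ℤ.- + L))
  (ff (y + ℕ→ℚ m - ℕ→ℚ k - half) ((ℤ.+ 2) ℤ.* + m ℤ.- (ℤ.+ 2) ℤ.* + k))
  (ff (y - ℕ→ℚ (m ℕ.+ L) - (+ 3) / 2) (+ k ℤ.- + L))
  ((y * y - ℤ→ℚ i * ℤ→ℚ i) * (ℤ→ℚ i + ℕ→ℚ (3 ℕ.* m ℕ.+ L) + (+ 5) / 2)
    + (ℤ→ℚ i + ℕ→ℚ (m ℕ.+ L) + half) * (ℤ→ℚ i + ℕ→ℚ m - ℕ→ℚ k + half) * (ℤ→ℚ i + ℕ→ℚ (m ℕ.+ k) + (+ 3) / 2))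
  (risingDownProd-vanishes k+L<2*L)
  where
  k+L<2*L : k ℕ.+ L < 2 ℕ.* L
  k+L<2*L = subst (k ℕ.+ L <_) (cong (L ℕ.+_) (sym (ℕP.+-identityʳ L))) (ℕP.+-monoˡ-< L k<L)

lemma3 : (y : ℚ) → ¬ HalfInteger y → (i : ℤ) (m k l : ℕ) →
         N y i m k l ≡ RHS y i m k l
lemma3 y y∉½ℤ i m k l = begin
  N y i m k l
    ≡⟨ sumFromTo-linear l k (G y (ℤ.suc i) m k) (G y i m k) (G y (ℤ.pred i) (suc m) k)
         (- ((+ 2) / 1)) (N-middle-coefficient y i m k) (N-last-coefficient i m) ⟩
  sumFromTo l k (N-summand y i m k)
    ≡⟨ sumFromTo≡sumFrom l k (N-summand y i m k) ⟩
  sumFrom l (N-summand y i m k) (suc k ∸ l)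
    ≡⟨ sumFrom-telescope l (N-summand y i m k) (RHS y i m k) (N-summand-telescopes y∉½ℤ i m k) (suc k ∸ l) ⟩
  RHS y i m k l - RHS y i m k (l ℕ.+ (suc k ∸ l))
    ≡⟨ cong (λ r → RHS y i m k l - r) (RHS-vanishes y i m k _ (ℕP.m≤n+m∸n (suc k) l)) ⟩
  RHS y i m k l - 0ℚ
    ≡⟨ ℚP.+-identityʳ (RHS y i m k l) ⟩
  RHS y i m k l ∎
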